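{- Let $F,F',G,G'$ be graphs all with the same vertex set $W\subseteq\{v_1,\dots,v_n\}$, such that $F\cong F'$, $|E(G)|=|E(G')|$ and $E(F)\cap E(G)=E(F')\cap E(G')=\emptyset$. Then $$\pi\big(F\cup G,\mathcal K(F,G)\big)=\pi\big(F'\cup G',\mathcal K(F',G')\big),$$ where $\mathcal K(F,G)$ is the set of all clique covers $\mathcal C$ of $F\cup G$ with $E(G)\subseteq\mathcal C\subseteq\mathcal P(F\cup G)\setminus E(F)$ (edges being regarded as $2$-element vertex sets).
   Context: Random intersection graph $\mathcal G(n,m,p)$: vertex set $\{v_1,\dots,v_n\}$, attribute set $\{a_1,\dots,a_m\}$; each vertex chooses each attribute independently with probability $p$; vertices are adjacent iff they share an attribute. $F\cup G=(V(F)\cup V(G),E(F)\cup E(G))$. For a graph $H$, $\mathcal P(H)$ is the family of subsets of $V(H)$ containing both ends of at least one edge of $H$. A family $\mathcal C\subseteq\mathcal P(H)$ is a clique cover of $H$ if every edge of $H$ is contained in some $C\in\mathcal C$. An attribute builds $C\subseteq V(H)$ if all vertices of $C$ chose it and no vertex of $V(H)\setminus C$ chose it. $H$ is given by the clique cover $\mathcal C$ if every $C\in\mathcal C$ is built by some attribute and no $C\in\mathcal P(H)\setminus\mathcal C$ is built by any attribute; $\pi(H,\mathcal C)$ is its probability, and for a family $\mathcal K$ of clique covers, $\pi(H,\mathcal K)=\sum_{\mathcal C\in\mathcal K}\pi(H,\mathcal C)$.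
   Formalization: The attribute probability p takes rational values in [0,1] rather than real values. -}

module Defs where

open import Data.Bool using (Bool; true; false; _∧_; _∨_; not; if_then_else_)
open import Data.Nat using (ℕ; zero; suc; _∸_)
open import Data.Fin using (Fin)
open import Data.Fin.Subset using (Subset; inside; outside; _∈_; _∪_; ⁅_⁆; ∣_∣)
open import Data.Fin.Permutation using (Permutation′; _⟨$⟩ʳ_)
open import Data.Vec using (Vec; []; _∷_; lookup)
open import Data.List using (List; []; _∷_; map; _++_; allFin)
open import Data.Product using (Σ; _×_)
open import Data.Rational using (ℚ; 0ℚ; 1ℚ; _+_; _*_; _-_)
open import Relation.Binary.PropositionalEquality using (_≡_)

anyL : {A : Set} → (A → Bool) → List A → Bool
anyL f [] = false
anyL f (x ∷ xs) = f x ∨ anyL f xs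

allL : {A : Set} → (A → Bool) → List A → Bool
allL f [] = true
allL f (x ∷ xs) = f x ∧ allL f xs

filterL : {A : Set} → (A → Bool) → List A → List A
filterL f [] = []
filterL f (x ∷ xs) = if f x then x ∷ filterL f xs else filterL f xs

countL : {A : Set} → (A → Bool) → List A → ℕ
countL f [] = 0
countL f (x ∷ xs) = if f x then suc (countL f xs) else countL f xs

anyV : {A : Set} {m : ℕ} → (A → Bool) → Vec A m → Bool
anyV f [] = false
anyV f (x ∷ xs) = f x ∨ anyV f xs

-- all sublists (= all subfamilies of a list of distinct elements)
sublists : {A : Set} → List A → List (List A)
sublists [] = [] ∷ []
sublists (x ∷ xs) = sublists xs ++ map (x ∷_) (sublists xs)

vecsOf : {A : Set} → List A → (m : ℕ) → List (Vec A m)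
vecsOf xs zero = [] ∷ []
vecsOf xs (suc m) = concatL (map (λ x → map (x ∷_) (vecsOf xs m)) xs)
  where
  concatL : {B : Set} → List (List B) → List B
  concatL [] = []
  concatL (ys ∷ yss) = ys ++ concatL yss

sumℚ : List ℚ → ℚ
sumℚ [] = 0ℚ
sumℚ (x ∷ xs) = x + sumℚ xs

_^ℚ_ : ℚ → ℕ → ℚ
p ^ℚ zero = 1ℚ
p ^ℚ suc k = p * (p ^ℚ k)

allSubsets : (n : ℕ) → List (Subset n)
allSubsets zero = [] ∷ []
allSubsets (suc n) = map (outside ∷_) (allSubsets n) ++ map (inside ∷_) (allSubsets n)

eqSubB : {n : ℕ} → Subset n → Subset n → Bool
eqSubB [] [] = true
eqSubB (true ∷ xs) (true ∷ ys) = eqSubB xs ys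
eqSubB (false ∷ xs) (false ∷ ys) = eqSubB xs ys
eqSubB (true ∷ xs) (false ∷ ys) = false
eqSubB (false ∷ xs) (true ∷ ys) = false

subB : {n : ℕ} → Subset n → Subset n → Bool
subB [] [] = true
subB (true ∷ xs) (y ∷ ys) = y ∧ subB xs ys
subB (false ∷ xs) (y ∷ ys) = subB xs ys

memB : {n : ℕ} → Subset n → List (Subset n) → Bool
memB C 𝒞 = anyL (eqSubB C) 𝒞

Adj : ℕ → Set
Adj n = Fin n → Fin n → Bool

record Graph (n : ℕ) (W : Subset n) : Set where
  field
    adj    : Adj n
    sym    : ∀ u v → adj u v ≡ adj v u
    irrefl : ∀ u → adj u u ≡ false
    inW    : ∀ u v → adj u v ≡ true → (u ∈ W × v ∈ W)
open Graph public

_∪ₐ_ : {n : ℕ} → Adj n → Adj n → Adj n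
(A ∪ₐ B) u v = A u v ∨ B u v

edgeSet : {n : ℕ} → Fin n → Fin n → Subset n
edgeSet u v = ⁅ u ⁆ ∪ ⁅ v ⁆

isEdgeB : {n : ℕ} → Adj n → Subset n → Bool
isEdgeB {n} A C = anyL (λ u → anyL (λ v → A u v ∧ eqSubB C (edgeSet u v)) (allFin n)) (allFin n)

edgeCount : {n : ℕ} → Adj n → ℕ
edgeCount {n} A = countL (isEdgeB A) (allSubsets n)

-- F ≅ F' (both with vertex set W): a bijection of the vertex set preserving adjacency
-- (expressed as a permutation of {v_1,…,v_n} mapping W into W)
Isomorphic : {n : ℕ} {W : Subset n} → Graph n W → Graph n W → Set
Isomorphic {n} {W} F F' =
  Σ (Permutation′ n) λ σ →
    (∀ u → u ∈ W → (σ ⟨$⟩ʳ u) ∈ W) ×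
    (∀ u v → adj F u v ≡ adj F' (σ ⟨$⟩ʳ u) (σ ⟨$⟩ʳ v))

-- C ∈ 𝒫(H): C ⊆ V(H) = W and C contains both ends of some edge of H
inPB : {n : ℕ} → Subset n → Adj n → Subset n → Bool
inPB {n} W A C =
  subB C W ∧ anyL (λ u → anyL (λ v → A u v ∧ lookup C u ∧ lookup C v) (allFin n)) (allFin n)

PList : {n : ℕ} → Subset n → Adj n → List (Subset n)
PList {n} W A = filterL (inPB W A) (allSubsets n)

-- 𝒞 is a clique cover of H (given 𝒞 ⊆ 𝒫(H)): every edge lies in some C ∈ 𝒞
coverB : {n : ℕ} → Adj n → List (Subset n) → Bool
coverB {n} A 𝒞 =
  allL (λ u → allL (λ v → not (A u v) ∨ anyL (λ C → lookup C u ∧ lookup C v) 𝒞) (allFin n)) (allFin n)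

-- Probability in 𝒢(n,m,p), restricted to what matters for H with V(H) = W:
-- an outcome records, for each attribute a_1,…,a_m, the set S ⊆ W of
-- vertices of W choosing it; P(S) = p^|S| (1-p)^(|W|-|S|), independently.

subsetsOf : {n : ℕ} → Subset n → List (Subset n)
subsetsOf {n} W = filterL (λ S → subB S W) (allSubsets n)

weight : {n : ℕ} → ℚ → Subset n → Subset n → ℚ
weight p W S = (p ^ℚ ∣ S ∣) * ((1ℚ - p) ^ℚ (∣ W ∣ ∸ ∣ S ∣))

probOutcome : {n m : ℕ} → ℚ → Subset n → Vec (Subset n) m → ℚ
probOutcome p W [] = 1ℚ
probOutcome p W (S ∷ ω) = weight p W S * probOutcome p W ω

builtB : {n m : ℕ} → Subset n → Vec (Subset n) m → Bool
builtB C ω = anyV (eqSubB C) ω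

givenByB : {n m : ℕ} → Subset n → Adj n → List (Subset n) → Vec (Subset n) m → Bool
givenByB W A 𝒞 ω =
  allL (λ C → if memB C 𝒞 then builtB C ω else not (builtB C ω)) (PList W A)

πH : {n : ℕ} → (m : ℕ) → ℚ → Subset n → Adj n → List (Subset n) → ℚ
πH m p W A 𝒞 =
  sumℚ (map (λ ω → if givenByB W A 𝒞 ω then probOutcome p W ω else 0ℚ) (vecsOf (subsetsOf W) m))

inKB : {n : ℕ} → Adj n → Adj n → List (Subset n) → Bool
inKB {n} F G 𝒞 =
  coverB (F ∪ₐ G) 𝒞 ∧
  allL (λ u → allL (λ v → not (G u v) ∨ memB (edgeSet u v) 𝒞) (allFin n)) (allFin n) ∧
  allL (λ C → not (isEdgeB F C)) 𝒞

πK : {n : ℕ} → (m : ℕ) → ℚ → (W : Subset n) → Graph n W → Graph n W → ℚ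
πK m p W F G =
  sumℚ (map (λ 𝒞 → if inKB (adj F) (adj G) 𝒞 then πH m p W (adj F ∪ₐ adj G) 𝒞 else 0ℚ)
            (sublists (PList W (adj F ∪ₐ adj G))))

{-# OPTIONS --safe #-}
-- Summing π(F ∪ G, 𝒞) over 𝒞 ∈ 𝒦(F,G) regroups the outcomes by the family of sets that
-- their attributes build, so π(F ∪ G, 𝒦(F,G)) is the probability that the attributes build
-- every edge of G and no edge of F, while every edge of F lies inside the set of some attribute.
-- Applying a size-preserving permutation of the subsets of W to all attribute sets preserves
-- the product measure, and turns this event into the same event for the permuted edge sets as
-- long as inclusions of edges of F are preserved. Relabelling vertices along F ≅ F′ is such a
-- permutation; so is swapping two 2-subsets of W that are not edges of F′, and since
-- |E(G)| = |E(G′)|, finitely many such swaps move the relabelled edges of G onto those of G′.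
module Submission where

open import Defs hiding (sym)

open import Algebra.Bundles using (CommutativeMonoid)
open import Data.Bool using (Bool; true; false; _∧_; _∨_; not; if_then_else_)
open import Data.Bool.Properties using (_≟_)
open import Data.Empty using (⊥-elim)
open import Data.Fin using (Fin; zero; suc)
open import Data.Fin.Permutation using (Permutation′; _⟨$⟩ʳ_; _⟨$⟩ˡ_; inverseˡ; inverseʳ; flip)
open import Data.Fin.Subset using (Subset; inside; outside; _⊆_; ⁅_⁆; ∣_∣) renaming (_∈_ to _∈ₛ_)
open import Data.Fin.Subset.Properties
  using (⊆-antisym; drop-∷-⊆; ∪-identityˡ; ∪-identityʳ; p⊆q⇒∣p∣≤∣q∣; x∈p∪q⁻; x∈p∪q⁺; x∈⁅x⁆; x∈⁅y⁆⇒x≡y; ∣⁅x⁆∣≡1)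
open import Data.List using (List; []; _∷_; map; _++_; allFin; filter; length; concat; foldr)
import Data.List as List
open import Data.List.Membership.Propositional using (_∈_; _∉_)
open import Data.List.Membership.Propositional.Properties
  using (∈-filter⁺; ∈-filter⁻; ∈-map⁺; ∈-map⁻; ∈-concat⁻′; ∈-++⁺ˡ; ∈-++⁺ʳ; ∈-++⁻; ∈-allFin)
open import Data.List.Membership.Propositional.Properties.WithK using (unique∧set⇒bag)
open import Data.List.Properties using (map-∘; map-cong-local; map-tabulate)
open import Data.List.Relation.Binary.BagAndSetEquality using (∼bag⇒↭)
open import Data.List.Relation.Binary.Permutation.Propositional using (_↭_; ↭-sym; ↭⇒↭ₛ)
open import Data.List.Relation.Binary.Permutation.Propositional.Properties using (∈-resp-↭; filter-↭; ↭-length)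
import Data.List.Relation.Binary.Permutation.Propositional.Properties as Perm
open import Data.List.Relation.Binary.Permutation.Setoid.Properties using (foldr-commMonoid)
import Data.List.Relation.Unary.All as All
import Data.List.Relation.Unary.AllPairs as AllPairs
open import Data.List.Relation.Unary.Any using (here; there)
open import Data.List.Relation.Unary.Unique.Propositional using (Unique)
import Data.List.Relation.Unary.Unique.Propositional.Properties as Unique
open import Data.Nat using (ℕ; zero; suc; _∸_; z≤n; s≤s)
import Data.Nat as ℕ
open import Data.Nat.Properties using (m≤n⇒m≤1+n; suc-injective; <-irrefl; ≤-refl; ≤-pred; <-≤-trans; n≮0)
open import Data.Product using (∃-syntax; _×_; _,_; proj₁; proj₂)
open import Data.Rational using (ℚ; 0ℚ; 1ℚ; _≤_; _+_; _*_; _-_)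
open import Data.Rational.Properties using (+-identityˡ; +-identityʳ; +-assoc; +-0-commutativeMonoid)
open import Data.Sum using (_⊎_; inj₁; inj₂)
open import Data.Vec using (Vec; []; _∷_; lookup; here; there)
import Data.Vec as Vec
open import Data.Vec.Properties using ([]=⇒lookup; lookup⇒[]=; lookup∘tabulate; tabulate-cong; tabulate∘lookup)
import Data.Vec.Relation.Unary.All as VecAll
open import Data.Vec.Relation.Unary.All.Properties using (lookup⁺)
open import Function using (_∘_; id)
open import Function.Bundles using (mk⇔)
open import Relation.Binary.PropositionalEquality
  using (_≡_; _≢_; refl; sym; trans; cong; cong₂; subst; module ≡-Reasoning)
open import Relation.Nullary using (¬_)

open import Algebra.Properties.CommutativeSemigroup
  (CommutativeMonoid.commutativeSemigroup +-0-commutativeMonoid) using (interchange)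

private variable
  A B : Set
  m n : ℕ

true⇔true⇒≡ : {a b : Bool} → (a ≡ true → b ≡ true) → (b ≡ true → a ≡ true) → a ≡ b
true⇔true⇒≡ {false} {false} _ _ = refl
true⇔true⇒≡ {false} {true}  _ g = g refl
true⇔true⇒≡ {true}  {false} f _ = sym (f refl)
true⇔true⇒≡ {true}  {true}  _ _ = refl

¬true⇒false : {a : Bool} → ¬ (a ≡ true) → a ≡ false
¬true⇒false {false} _ = refl
¬true⇒false {true}  h = ⊥-elim (h refl)

true≢false : {a : Bool} → a ≡ true → a ≢ false
true≢false refl ()

∧-true⁺ : {a b : Bool} → a ≡ true → b ≡ true → a ∧ b ≡ true
∧-true⁺ refl refl = refl

∧-true⁻ : {a b : Bool} → a ∧ b ≡ true → a ≡ true × b ≡ true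
∧-true⁻ {true} e = refl , e

∨-true⁺ˡ : {a b : Bool} → a ≡ true → a ∨ b ≡ true
∨-true⁺ˡ refl = refl

∨-true⁺ʳ : {a b : Bool} → b ≡ true → a ∨ b ≡ true
∨-true⁺ʳ {true}  _ = refl
∨-true⁺ʳ {false} e = e

∨-true⁻ : {a b : Bool} → a ∨ b ≡ true → a ≡ true ⊎ b ≡ true
∨-true⁻ {true}  _ = inj₁ refl
∨-true⁻ {false} e = inj₂ e

not-true⇒false : {a : Bool} → not a ≡ true → a ≡ false
not-true⇒false {false} _ = refl

⇒-true⁺ : {a b : Bool} → (a ≡ true → b ≡ true) → not a ∨ b ≡ true
⇒-true⁺ {false} _ = refl
⇒-true⁺ {true}  h = h refl

⇒-true⁻ : {a b : Bool} → not a ∨ b ≡ true → a ≡ true → b ≡ true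
⇒-true⁻ {true} e refl = e

if-swap : (a b : Bool) (q : ℚ) →
  (if a then (if b then q else 0ℚ) else 0ℚ) ≡ (if b then (if a then q else 0ℚ) else 0ℚ)
if-swap true  b     q = refl
if-swap false true  q = refl
if-swap false false q = refl

anyL-true⁺ : (f : A → Bool) {x : A} {xs : List A} → x ∈ xs → f x ≡ true → anyL f xs ≡ true
anyL-true⁺ f (here refl) e = ∨-true⁺ˡ e
anyL-true⁺ f {xs = y ∷ _} (there x∈xs) e = ∨-true⁺ʳ {f y} (anyL-true⁺ f x∈xs e)

anyL-true⁻ : (f : A → Bool) (xs : List A) → anyL f xs ≡ true → ∃[ x ] x ∈ xs × f x ≡ true
anyL-true⁻ f (y ∷ xs) e with ∨-true⁻ {f y} e
... | inj₁ fy = y , here refl , fy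
... | inj₂ rest with anyL-true⁻ f xs rest
...   | x , x∈xs , fx = x , there x∈xs , fx

allL-true⁺ : (f : A → Bool) (xs : List A) → (∀ x → x ∈ xs → f x ≡ true) → allL f xs ≡ true
allL-true⁺ f []       _ = refl
allL-true⁺ f (x ∷ xs) h = ∧-true⁺ (h x (here refl)) (allL-true⁺ f xs (λ y → h y ∘ there))

allL-true⁻ : (f : A → Bool) {xs : List A} → allL f xs ≡ true → ∀ x → x ∈ xs → f x ≡ true
allL-true⁻ f e x (here refl) = proj₁ (∧-true⁻ e)
allL-true⁻ f {y ∷ _} e x (there x∈xs) = allL-true⁻ f (proj₂ (∧-true⁻ {f y} e)) x x∈xs

allL-cong : (f g : A → Bool) (xs : List A) → (∀ x → x ∈ xs → f x ≡ g x) → allL f xs ≡ allL g xs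
allL-cong f g []       _ = refl
allL-cong f g (x ∷ xs) h = cong₂ _∧_ (h x (here refl)) (allL-cong f g xs (λ y → h y ∘ there))

allL-map : (f : B → Bool) (g : A → B) (xs : List A) → allL f (map g xs) ≡ allL (f ∘ g) xs
allL-map f g []       = refl
allL-map f g (x ∷ xs) = cong (f (g x) ∧_) (allL-map f g xs)

allL-↭ : (f : A → Bool) {xs ys : List A} → xs ↭ ys → allL f xs ≡ allL f ys
allL-↭ f {xs} {ys} xs↭ys = true⇔true⇒≡
  (λ e → allL-true⁺ f ys λ x x∈ys → allL-true⁻ f e x (∈-resp-↭ (↭-sym xs↭ys) x∈ys))
  (λ e → allL-true⁺ f xs λ x x∈xs → allL-true⁻ f e x (∈-resp-↭ xs↭ys x∈xs))

filterL≡filter : (f : A → Bool) (xs : List A) → filterL f xs ≡ filter (λ x → f x ≟ true) xs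
filterL≡filter f []       = refl
filterL≡filter f (x ∷ xs) with f x
... | true  = cong (x ∷_) (filterL≡filter f xs)
... | false = filterL≡filter f xs

∈-filterL⁺ : (f : A → Bool) {x : A} {xs : List A} → x ∈ xs → f x ≡ true → x ∈ filterL f xs
∈-filterL⁺ f {xs = xs} x∈xs fx
  rewrite filterL≡filter f xs = ∈-filter⁺ (λ x → f x ≟ true) x∈xs fx

∈-filterL⁻ : (f : A → Bool) {x : A} (xs : List A) → x ∈ filterL f xs → x ∈ xs × f x ≡ true
∈-filterL⁻ f xs x∈ rewrite filterL≡filter f xs = ∈-filter⁻ (λ x → f x ≟ true) x∈

filterL-unique : (f : A → Bool) {xs : List A} → Unique xs → Unique (filterL f xs)
filterL-unique f {xs} u rewrite filterL≡filter f xs = Unique.filter⁺ (λ x → f x ≟ true) u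

countL≡length∘filterL : (f : A → Bool) (xs : List A) → countL f xs ≡ length (filterL f xs)
countL≡length∘filterL f []       = refl
countL≡length∘filterL f (x ∷ xs) with f x
... | true  = cong suc (countL≡length∘filterL f xs)
... | false = countL≡length∘filterL f xs

countL-↭ : (f : A → Bool) {xs ys : List A} → xs ↭ ys → countL f xs ≡ countL f ys
countL-↭ f {xs} {ys} xs↭ys
  rewrite countL≡length∘filterL f xs | countL≡length∘filterL f ys
        | filterL≡filter f xs | filterL≡filter f ys
  = ↭-length (filter-↭ (λ x → f x ≟ true) xs↭ys)

countL-map : (f : B → Bool) (g : A → B) (xs : List A) → countL f (map g xs) ≡ countL (f ∘ g) xs
countL-map f g []       = refl
countL-map f g (x ∷ xs) with f (g x)
... | true  = cong suc (countL-map f g xs)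
... | false = countL-map f g xs

countL-cong : (f g : A → Bool) (xs : List A) → (∀ x → f x ≡ g x) → countL f xs ≡ countL g xs
countL-cong f g []       _ = refl
countL-cong f g (x ∷ xs) h rewrite h x with g x
... | true  = cong suc (countL-cong f g xs h)
... | false = countL-cong f g xs h

countL-mono : (f g : A → Bool) (xs : List A) → (∀ {x} → x ∈ xs → f x ≡ true → g x ≡ true) →
  countL f xs ℕ.≤ countL g xs
countL-mono f g []       _ = z≤n
countL-mono f g (x ∷ xs) h with f x in fx | g x in gx
... | true  | true  = s≤s (countL-mono f g xs (h ∘ there))
... | true  | false = ⊥-elim (true≢false (h (here refl) fx) gx)
... | false | true  = m≤n⇒m≤1+n (countL-mono f g xs (h ∘ there))
... | false | false = countL-mono f g xs (h ∘ there)

countL-mono-< : (f g : A → Bool) {xs : List A} → (∀ {x} → x ∈ xs → f x ≡ true → g x ≡ true) →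
  ∀ {x} → x ∈ xs → g x ≡ true → f x ≡ false → countL f xs ℕ.< countL g xs
countL-mono-< f g {_ ∷ xs} h (here refl) gx fx rewrite gx | fx = s≤s (countL-mono f g xs (h ∘ there))
countL-mono-< f g {y ∷ xs} h (there x∈xs) gx fx with f y in fy | g y in gy
... | true  | true  = s≤s (countL-mono-< f g (h ∘ there) x∈xs gx fx)
... | true  | false = ⊥-elim (true≢false (h (here refl) fy) gy)
... | false | true  = m≤n⇒m≤1+n (countL-mono-< f g (h ∘ there) x∈xs gx fx)
... | false | false = countL-mono-< f g (h ∘ there) x∈xs gx fx

⊆-or-witness : (f g : A → Bool) (xs : List A) →
  (∀ {x} → x ∈ xs → f x ≡ true → g x ≡ true) ⊎ (∃[ x ] x ∈ xs × f x ≡ true × g x ≡ false)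
⊆-or-witness f g [] = inj₁ λ ()
⊆-or-witness f g (x ∷ xs) with f x in fx | g x in gx | ⊆-or-witness f g xs
... | true | false | _ = inj₂ (x , here refl , fx , gx)
... | _ | _ | inj₂ (y , y∈xs , fy , gy) = inj₂ (y , there y∈xs , fy , gy)
... | false | _ | inj₁ f⊆g = inj₁ λ { (here refl) fx′ → ⊥-elim (true≢false fx′ fx) ; (there y∈xs) → f⊆g y∈xs }
... | true | true | inj₁ f⊆g = inj₁ λ { (here refl) _ → gx ; (there y∈xs) → f⊆g y∈xs }

countL-≡⇒≗-or-exchange : (f g : A → Bool) (xs : List A) → countL f xs ≡ countL g xs →
  (∀ {x} → x ∈ xs → f x ≡ g x) ⊎
  ((∃[ a ] a ∈ xs × f a ≡ true × g a ≡ false) × (∃[ b ] b ∈ xs × g b ≡ true × f b ≡ false))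
countL-≡⇒≗-or-exchange f g xs f≡g with ⊆-or-witness f g xs | ⊆-or-witness g f xs
... | inj₁ f⊆g | inj₁ g⊆f = inj₁ λ x∈ → true⇔true⇒≡ (f⊆g x∈) (g⊆f x∈)
... | inj₂ a   | inj₂ b   = inj₂ (a , b)
... | inj₁ f⊆g | inj₂ (b , b∈ , gb , fb) = ⊥-elim (<-irrefl f≡g (countL-mono-< f g f⊆g b∈ gb fb))
... | inj₂ (a , a∈ , fa , ga) | inj₁ g⊆f = ⊥-elim (<-irrefl (sym f≡g) (countL-mono-< g f g⊆f a∈ fa ga))

∑ : List A → (A → ℚ) → ℚ
∑ xs f = sumℚ (map f xs)

∑-cong : (xs : List A) {f g : A → ℚ} → (∀ {x} → x ∈ xs → f x ≡ g x) → ∑ xs f ≡ ∑ xs g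
∑-cong xs f≡g = cong sumℚ (map-cong-local (All.tabulate f≡g))

∑-map : (g : A → B) (xs : List A) (f : B → ℚ) → ∑ (map g xs) f ≡ ∑ xs (f ∘ g)
∑-map g xs f = cong sumℚ (sym (map-∘ xs))

∑-zero : (xs : List A) → ∑ xs (λ _ → 0ℚ) ≡ 0ℚ
∑-zero []       = refl
∑-zero (x ∷ xs) = trans (+-identityˡ _) (∑-zero xs)

∑-++ : (xs ys : List A) (f : A → ℚ) → ∑ (xs ++ ys) f ≡ ∑ xs f + ∑ ys f
∑-++ []       ys f = sym (+-identityˡ _)
∑-++ (x ∷ xs) ys f = trans (cong (f x +_) (∑-++ xs ys f)) (sym (+-assoc (f x) _ _))

∑-concat : (xss : List (List A)) (f : A → ℚ) → ∑ (concat xss) f ≡ ∑ xss (λ xs → ∑ xs f)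
∑-concat []         f = refl
∑-concat (xs ∷ xss) f = trans (∑-++ xs (concat xss) f) (cong (∑ xs f +_) (∑-concat xss f))

∑-+ : (xs : List A) (f g : A → ℚ) → ∑ xs (λ x → f x + g x) ≡ ∑ xs f + ∑ xs g
∑-+ []       f g = sym (+-identityˡ 0ℚ)
∑-+ (x ∷ xs) f g = trans (cong (f x + g x +_) (∑-+ xs f g)) (interchange (f x) (g x) _ _)

∑-comm : (xs : List A) (ys : List B) (f : A → B → ℚ) →
  ∑ xs (λ x → ∑ ys (f x)) ≡ ∑ ys (λ y → ∑ xs (λ x → f x y))
∑-comm []       ys f = sym (∑-zero ys)
∑-comm (x ∷ xs) ys f = trans (cong (∑ ys (f x) +_) (∑-comm xs ys f)) (sym (∑-+ ys (f x) _))

sumℚ≡foldr : (qs : List ℚ) → sumℚ qs ≡ foldr _+_ 0ℚ qs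
sumℚ≡foldr []       = refl
sumℚ≡foldr (q ∷ qs) = cong (q +_) (sumℚ≡foldr qs)

∑-↭ : {xs ys : List A} (f : A → ℚ) → xs ↭ ys → ∑ xs f ≡ ∑ ys f
∑-↭ {xs = xs} {ys} f xs↭ys = begin
  sumℚ (map f xs)          ≡⟨ sumℚ≡foldr (map f xs) ⟩
  foldr _+_ 0ℚ (map f xs)  ≡⟨ foldr-commMonoid ℚ-+.setoid ℚ-+.isCommutativeMonoid (↭⇒↭ₛ (Perm.map⁺ f xs↭ys)) ⟩
  foldr _+_ 0ℚ (map f ys)  ≡⟨ sym (sumℚ≡foldr (map f ys)) ⟩
  sumℚ (map f ys)          ∎
  where
  open ≡-Reasoning
  module ℚ-+ = CommutativeMonoid +-0-commutativeMonoid

∑-if : (b : Bool) (xs : List A) (f : A → ℚ) →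
  (if b then ∑ xs f else 0ℚ) ≡ ∑ xs (λ x → if b then f x else 0ℚ)
∑-if true  xs f = refl
∑-if false xs f = sym (∑-zero xs)

prependEach : List (Vec A m) → A → List (Vec A (suc m))
prependEach ωs x = map (x ∷_) ωs

mutual
  private
    -- `vecsOf` concatenates with a where-bound function that cannot be named
    -- outside Defs; this meta is solved to it by unification in vecsOf-suc′.
    concatᵥ : List A → (m : ℕ) → List (List (Vec A (suc m))) → List (Vec A (suc m))
    concatᵥ = λ L m yss → _

  vecsOf-suc′ : (L : List A) (m : ℕ) → vecsOf L (suc m) ≡ concatᵥ L m (map (prependEach (vecsOf L m)) L)
  vecsOf-suc′ L m with map (prependEach (vecsOf L m)) L
  ... | yss = refl

vecsOf-suc : (L : List A) (m : ℕ) → vecsOf L (suc m) ≡ concat (map (prependEach (vecsOf L m)) L)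
vecsOf-suc {A = A} L m = trans (vecsOf-suc′ L m) (concatᵥ≡concat (map (prependEach (vecsOf L m)) L))
  where
  concatᵥ≡concat : (yss : List (List (Vec A (suc m)))) → concatᵥ L m yss ≡ concat yss
  concatᵥ≡concat []         = refl
  concatᵥ≡concat (ys ∷ yss) = cong (ys ++_) (concatᵥ≡concat yss)

∑-vecsOf-suc : (L : List A) (m : ℕ) (g : Vec A (suc m) → ℚ) →
  ∑ (vecsOf L (suc m)) g ≡ ∑ L (λ x → ∑ (vecsOf L m) (λ ω → g (x ∷ ω)))
∑-vecsOf-suc L m g = begin
  ∑ (vecsOf L (suc m)) g
    ≡⟨ cong (λ ωs → ∑ ωs g) (vecsOf-suc L m) ⟩
  ∑ (concat (map (prependEach (vecsOf L m)) L)) g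
    ≡⟨ ∑-concat (map (prependEach (vecsOf L m)) L) g ⟩
  ∑ (map (prependEach (vecsOf L m)) L) (λ ωs → ∑ ωs g)
    ≡⟨ ∑-map (prependEach (vecsOf L m)) L (λ ωs → ∑ ωs g) ⟩
  ∑ L (λ x → ∑ (prependEach (vecsOf L m) x) g)
    ≡⟨ ∑-cong L (λ {x} _ → ∑-map (x ∷_) (vecsOf L m) g) ⟩
  ∑ L (λ x → ∑ (vecsOf L m) (λ ω → g (x ∷ ω)))  ∎
  where open ≡-Reasoning

∑-vecsOf-map : (L : List A) (φ : A → A) → map φ L ↭ L → (m : ℕ) (g : Vec A m → ℚ) →
  ∑ (vecsOf L m) g ≡ ∑ (vecsOf L m) (g ∘ Vec.map φ)
∑-vecsOf-map L φ φL↭L zero    g = refl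
∑-vecsOf-map {A = A} L φ φL↭L (suc m) g = begin
  ∑ (vecsOf L (suc m)) g                      ≡⟨ ∑-vecsOf-suc L m g ⟩
  ∑ L (λ x → ∑ (vecsOf L m) (λ ω → g (x ∷ ω)))
    ≡⟨ ∑-cong L (λ {x} _ → ∑-vecsOf-map L φ φL↭L m (λ ω → g (x ∷ ω))) ⟩
  ∑ L h                                       ≡⟨ ∑-↭ h φL↭L ⟨
  ∑ (map φ L) h                               ≡⟨ ∑-map φ L h ⟩
  ∑ L (h ∘ φ)                                 ≡⟨ ∑-vecsOf-suc L m (g ∘ Vec.map φ) ⟨
  ∑ (vecsOf L (suc m)) (g ∘ Vec.map φ)        ∎
  where
  open ≡-Reasoning
  h : A → ℚ
  h x = ∑ (vecsOf L m) (λ ω → g (x ∷ Vec.map φ ω))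

∈-vecsOf⁻ : (L : List A) (m : ℕ) {ω : Vec A m} → ω ∈ vecsOf L m → VecAll.All (_∈ L) ω
∈-vecsOf⁻ L zero    (here refl) = VecAll.[]
∈-vecsOf⁻ L (suc m) ω∈ rewrite vecsOf-suc L m
  with ωs , ω∈ωs , ωs∈ ← ∈-concat⁻′ (map (prependEach (vecsOf L m)) L) ω∈
  with x , x∈L , refl ← ∈-map⁻ (prependEach (vecsOf L m)) ωs∈
  with ω′ , ω′∈ , refl ← ∈-map⁻ (x ∷_) ω∈ωs
  = x∈L VecAll.∷ ∈-vecsOf⁻ L m ω′∈

eqSubB-refl : (C : Subset n) → eqSubB C C ≡ true
eqSubB-refl []          = refl
eqSubB-refl (true ∷ C)  = eqSubB-refl C
eqSubB-refl (false ∷ C) = eqSubB-refl C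

eqSubB-true⁻ : (C D : Subset n) → eqSubB C D ≡ true → C ≡ D
eqSubB-true⁻ []          []          _ = refl
eqSubB-true⁻ (true ∷ C)  (true ∷ D)  e = cong (true ∷_) (eqSubB-true⁻ C D e)
eqSubB-true⁻ (false ∷ C) (false ∷ D) e = cong (false ∷_) (eqSubB-true⁻ C D e)

eqSubB-true⁺ : {C D : Subset n} → C ≡ D → eqSubB C D ≡ true
eqSubB-true⁺ {C = C} refl = eqSubB-refl C

eqSubB-false⁺ : (C D : Subset n) → C ≢ D → eqSubB C D ≡ false
eqSubB-false⁺ C D C≢D = ¬true⇒false (C≢D ∘ eqSubB-true⁻ C D)

subB-true⁻ : (C D : Subset n) → subB C D ≡ true → C ⊆ D
subB-true⁻ (true ∷ C)  (y ∷ D) e here       with refl ← proj₁ (∧-true⁻ {y} e) = here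
subB-true⁻ (true ∷ C)  (y ∷ D) e (there x∈) = there (subB-true⁻ C D (proj₂ (∧-true⁻ {y} e)) x∈)
subB-true⁻ (false ∷ C) (y ∷ D) e (there x∈) = there (subB-true⁻ C D e x∈)

subB-true⁺ : (C D : Subset n) → C ⊆ D → subB C D ≡ true
subB-true⁺ []          []      _   = refl
subB-true⁺ (true ∷ C)  (y ∷ D) C⊆D =
  ∧-true⁺ ([]=⇒lookup (C⊆D here)) (subB-true⁺ C D (drop-∷-⊆ C⊆D))
subB-true⁺ (false ∷ C) (y ∷ D) C⊆D = subB-true⁺ C D (drop-∷-⊆ C⊆D)

⊆∧∣≡∣⇒≡ : {C D : Subset n} → C ⊆ D → ∣ C ∣ ≡ ∣ D ∣ → C ≡ D
⊆∧∣≡∣⇒≡ {C = []}          {[]}          _   _ = refl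
⊆∧∣≡∣⇒≡ {C = true ∷ C}    {true ∷ D}    C⊆D c = cong (true ∷_) (⊆∧∣≡∣⇒≡ (drop-∷-⊆ C⊆D) (suc-injective c))
⊆∧∣≡∣⇒≡ {C = false ∷ C}   {false ∷ D}   C⊆D c = cong (false ∷_) (⊆∧∣≡∣⇒≡ (drop-∷-⊆ C⊆D) c)
⊆∧∣≡∣⇒≡ {C = false ∷ C}   {true ∷ D}    C⊆D c = ⊥-elim (<-irrefl c (s≤s (p⊆q⇒∣p∣≤∣q∣ (drop-∷-⊆ C⊆D))))
⊆∧∣≡∣⇒≡ {C = true ∷ C}    {false ∷ D}   C⊆D _ with () ← C⊆D here

∈-edgeSet⁻ : {u v x : Fin n} → x ∈ₛ edgeSet u v → x ≡ u ⊎ x ≡ v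
∈-edgeSet⁻ {u = u} {v} x∈ with x∈p∪q⁻ ⁅ u ⁆ ⁅ v ⁆ x∈
... | inj₁ x∈⁅u⁆ = inj₁ (x∈⁅y⁆⇒x≡y u x∈⁅u⁆)
... | inj₂ x∈⁅v⁆ = inj₂ (x∈⁅y⁆⇒x≡y v x∈⁅v⁆)

∈-edgeSetˡ : (u v : Fin n) → u ∈ₛ edgeSet u v
∈-edgeSetˡ u v = x∈p∪q⁺ (inj₁ (x∈⁅x⁆ u))

∈-edgeSetʳ : (u v : Fin n) → v ∈ₛ edgeSet u v
∈-edgeSetʳ u v = x∈p∪q⁺ {p = ⁅ u ⁆} (inj₂ (x∈⁅x⁆ v))

edgeSet-⊆ : {u v : Fin n} {D : Subset n} → u ∈ₛ D → v ∈ₛ D → edgeSet u v ⊆ D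
edgeSet-⊆ u∈D v∈D x∈ with ∈-edgeSet⁻ x∈
... | inj₁ refl = u∈D
... | inj₂ refl = v∈D

∣edgeSet∣≡2 : {u v : Fin n} → u ≢ v → ∣ edgeSet u v ∣ ≡ 2
∣edgeSet∣≡2 {u = zero}  {zero}  u≢v = ⊥-elim (u≢v refl)
∣edgeSet∣≡2 {u = zero}  {suc v} _   = cong suc (trans (cong ∣_∣ (∪-identityˡ ⁅ v ⁆)) (∣⁅x⁆∣≡1 v))
∣edgeSet∣≡2 {u = suc u} {zero}  _   = cong suc (trans (cong ∣_∣ (∪-identityʳ ⁅ u ⁆)) (∣⁅x⁆∣≡1 u))
∣edgeSet∣≡2 {u = suc u} {suc v} u≢v = ∣edgeSet∣≡2 (u≢v ∘ cong suc)

edgeSet-injective : {u v u′ v′ : Fin n} → u ≢ v → edgeSet u v ≡ edgeSet u′ v′ →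
  (u ≡ u′ × v ≡ v′) ⊎ (u ≡ v′ × v ≡ u′)
edgeSet-injective {u = u} {v} u≢v eq
  with ∈-edgeSet⁻ (subst (u ∈ₛ_) eq (∈-edgeSetˡ u v)) | ∈-edgeSet⁻ (subst (v ∈ₛ_) eq (∈-edgeSetʳ u v))
... | inj₁ u≡u′ | inj₂ v≡v′ = inj₁ (u≡u′ , v≡v′)
... | inj₂ u≡v′ | inj₁ v≡u′ = inj₂ (u≡v′ , v≡u′)
... | inj₁ u≡u′ | inj₁ v≡u′ = ⊥-elim (u≢v (trans u≡u′ (sym v≡u′)))
... | inj₂ u≡v′ | inj₂ v≡v′ = ⊥-elim (u≢v (trans u≡v′ (sym v≡v′)))

map-bijection-↭ : (f g : A → A) → (∀ x → g (f x) ≡ x) → (∀ x → f (g x) ≡ x) →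
  {xs : List A} → Unique xs → (∀ {x} → x ∈ xs → f x ∈ xs) → (∀ {x} → x ∈ xs → g x ∈ xs) → map f xs ↭ xs
map-bijection-↭ f g g∘f f∘g {xs} u f-closed g-closed = ∼bag⇒↭ (unique∧set⇒bag
  (Unique.map⁺ (λ {x} {y} fx≡fy → trans (sym (g∘f x)) (trans (cong g fx≡fy) (g∘f y))) u) u
  (mk⇔ to from))
  where
  to : ∀ {y} → y ∈ map f xs → y ∈ xs
  to y∈ with x , x∈xs , refl ← ∈-map⁻ f y∈ = f-closed x∈xs
  from : ∀ {y} → y ∈ xs → y ∈ map f xs
  from {y} y∈xs = subst (_∈ map f xs) (f∘g y) (∈-map⁺ f (g-closed y∈xs))

countL-∘-bijection : (f g : A → A) → (∀ x → g (f x) ≡ x) → (∀ x → f (g x) ≡ x) →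
  {xs : List A} → Unique xs → (∀ x → x ∈ xs) → (h : A → Bool) → countL (h ∘ f) xs ≡ countL h xs
countL-∘-bijection f g g∘f f∘g {xs} u complete h =
  trans (sym (countL-map h f xs)) (countL-↭ h (map-bijection-↭ f g g∘f f∘g u (λ _ → complete _) (λ _ → complete _)))

∈-allSubsets : (S : Subset n) → S ∈ allSubsets n
∈-allSubsets []                = here refl
∈-allSubsets {suc n} (false ∷ S) = ∈-++⁺ˡ (∈-map⁺ (outside ∷_) (∈-allSubsets S))
∈-allSubsets {suc n} (true ∷ S)  = ∈-++⁺ʳ (map (outside ∷_) (allSubsets n)) (∈-map⁺ (inside ∷_) (∈-allSubsets S))

allSubsets-unique : (n : ℕ) → Unique (allSubsets n)
allSubsets-unique zero    = All.[] AllPairs.∷ AllPairs.[]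
allSubsets-unique (suc n) = Unique.++⁺ (Unique.map⁺ ∷-injectiveʳ (allSubsets-unique n))
                                       (Unique.map⁺ ∷-injectiveʳ (allSubsets-unique n)) disjoint
  where
  ∷-injectiveʳ : {b : Bool} {S T : Subset n} → b ∷ S ≡ b ∷ T → S ≡ T
  ∷-injectiveʳ refl = refl
  disjoint : ∀ {S} → ¬ (S ∈ map (outside ∷_) (allSubsets n) × S ∈ map (inside ∷_) (allSubsets n))
  disjoint (S∈out , S∈in) with _ , _ , refl ← ∈-map⁻ (outside ∷_) S∈out with _ , _ , () ← ∈-map⁻ (inside ∷_) S∈in

countL-tabulate-suc : (f : Fin (suc n) → Bool) → countL f (List.tabulate suc) ≡ countL (f ∘ suc) (allFin n)
countL-tabulate-suc {n} f = trans (cong (countL f) (sym (map-tabulate id suc))) (countL-map f suc (allFin n))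

∣∣≡countL-lookup : (S : Subset n) → ∣ S ∣ ≡ countL (lookup S) (allFin n)
∣∣≡countL-lookup []          = refl
∣∣≡countL-lookup (true ∷ S)  = cong suc (trans (∣∣≡countL-lookup S) (sym (countL-tabulate-suc (lookup (true ∷ S)))))
∣∣≡countL-lookup (false ∷ S) = trans (∣∣≡countL-lookup S) (sym (countL-tabulate-suc (lookup (false ∷ S))))

relabel : Permutation′ n → Subset n → Subset n
relabel σ S = Vec.tabulate (λ j → lookup S (σ ⟨$⟩ˡ j))

lookup-relabel : (σ : Permutation′ n) (S : Subset n) (j : Fin n) → lookup (relabel σ S) j ≡ lookup S (σ ⟨$⟩ˡ j)
lookup-relabel σ S = lookup∘tabulate _

∈-relabel⁺ : (σ : Permutation′ n) {S : Subset n} {i : Fin n} → i ∈ₛ S → σ ⟨$⟩ʳ i ∈ₛ relabel σ S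
∈-relabel⁺ σ {S} {i} i∈S = lookup⇒[]= _ _ (begin
  lookup (relabel σ S) (σ ⟨$⟩ʳ i)  ≡⟨ lookup-relabel σ S (σ ⟨$⟩ʳ i) ⟩
  lookup S (σ ⟨$⟩ˡ (σ ⟨$⟩ʳ i))     ≡⟨ cong (lookup S) (inverseˡ σ) ⟩
  lookup S i                       ≡⟨ []=⇒lookup i∈S ⟩
  true                             ∎)
  where open ≡-Reasoning

∈-relabel⁻ : (σ : Permutation′ n) {S : Subset n} {j : Fin n} → j ∈ₛ relabel σ S → σ ⟨$⟩ˡ j ∈ₛ S
∈-relabel⁻ σ {S} {j} j∈ = lookup⇒[]= _ S (trans (sym (lookup-relabel σ S j)) ([]=⇒lookup j∈))

relabel-flip : (σ : Permutation′ n) (S : Subset n) → relabel (flip σ) (relabel σ S) ≡ S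
relabel-flip σ S = trans
  (tabulate-cong λ j → trans (lookup-relabel σ S (σ ⟨$⟩ʳ j)) (cong (lookup S) (inverseˡ σ)))
  (tabulate∘lookup S)

∣relabel∣ : (σ : Permutation′ n) (S : Subset n) → ∣ relabel σ S ∣ ≡ ∣ S ∣
∣relabel∣ {n} σ S = begin
  ∣ relabel σ S ∣                                  ≡⟨ ∣∣≡countL-lookup (relabel σ S) ⟩
  countL (lookup (relabel σ S)) (allFin n)         ≡⟨ countL-cong _ _ (allFin n) (lookup-relabel σ S) ⟩
  countL (lookup S ∘ (σ ⟨$⟩ˡ_)) (allFin n)         ≡⟨ countL-∘-bijection (σ ⟨$⟩ˡ_) (σ ⟨$⟩ʳ_) (λ _ → inverseʳ σ) (λ _ → inverseˡ σ) (Unique.allFin⁺ n) ∈-allFin (lookup S) ⟩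
  countL (lookup S) (allFin n)                     ≡⟨ ∣∣≡countL-lookup S ⟨
  ∣ S ∣                                            ∎
  where open ≡-Reasoning

relabel-edgeSet : (σ : Permutation′ n) (u v : Fin n) → relabel σ (edgeSet u v) ≡ edgeSet (σ ⟨$⟩ʳ u) (σ ⟨$⟩ʳ v)
relabel-edgeSet σ u v = ⊆-antisym
  (λ j∈ → relabelled-end (∈-edgeSet⁻ (∈-relabel⁻ σ j∈)))
  (edgeSet-⊆ (∈-relabel⁺ σ (∈-edgeSetˡ u v)) (∈-relabel⁺ σ (∈-edgeSetʳ u v)))
  where
  back : ∀ {j w} → σ ⟨$⟩ˡ j ≡ w → σ ⟨$⟩ʳ w ≡ j
  back refl = inverseʳ σ
  relabelled-end : ∀ {j} → σ ⟨$⟩ˡ j ≡ u ⊎ σ ⟨$⟩ˡ j ≡ v → j ∈ₛ edgeSet (σ ⟨$⟩ʳ u) (σ ⟨$⟩ʳ v)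
  relabelled-end (inj₁ σ⁻¹j≡u) = subst (_∈ₛ _) (back σ⁻¹j≡u) (∈-edgeSetˡ _ _)
  relabelled-end (inj₂ σ⁻¹j≡v) = subst (_∈ₛ _) (back σ⁻¹j≡v) (∈-edgeSetʳ _ _)

subB-relabel : (σ : Permutation′ n) (C D : Subset n) → subB (relabel σ C) (relabel σ D) ≡ subB C D
subB-relabel σ C D = true⇔true⇒≡
  (λ e → subB-true⁺ C D λ i∈ → subst (_∈ₛ D) (inverseˡ σ)
    (∈-relabel⁻ σ (subB-true⁻ (relabel σ C) (relabel σ D) e (∈-relabel⁺ σ i∈))))
  (λ e → subB-true⁺ (relabel σ C) (relabel σ D) λ j∈ → subst (_∈ₛ relabel σ D) (inverseʳ σ)
    (∈-relabel⁺ σ (subB-true⁻ C D e (∈-relabel⁻ σ j∈))))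

swapSubsets : Subset n → Subset n → Subset n → Subset n
swapSubsets a b S = if eqSubB S a then b else if eqSubB S b then a else S

data SwapView {n : ℕ} (a b S : Subset n) : Set where
  at-a      : S ≡ a → swapSubsets a b S ≡ b → SwapView a b S
  at-b      : S ≢ a → S ≡ b → swapSubsets a b S ≡ a → SwapView a b S
  elsewhere : S ≢ a → S ≢ b → swapSubsets a b S ≡ S → SwapView a b S

swapView : (a b S : Subset n) → SwapView a b S
swapView a b S with eqSubB S a in S≟a
... | true  = at-a (eqSubB-true⁻ S a S≟a) (cong (if_then b else (if eqSubB S b then a else S)) S≟a)
... | false with eqSubB S b in S≟b
...   | true  = at-b (λ { refl → true≢false (eqSubB-refl S) S≟a }) (eqSubB-true⁻ S b S≟b)
                     (trans (cong (if_then b else (if eqSubB S b then a else S)) S≟a) (cong (if_then a else S) S≟b))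
...   | false = elsewhere (λ { refl → true≢false (eqSubB-refl S) S≟a }) (λ { refl → true≢false (eqSubB-refl S) S≟b })
                          (trans (cong (if_then b else (if eqSubB S b then a else S)) S≟a) (cong (if_then a else S) S≟b))

module _ (a b : Subset n) where

  swap-at-a : swapSubsets a b a ≡ b
  swap-at-a with swapView a b a
  ... | at-a _ τa≡b        = τa≡b
  ... | at-b a≢a _ _       = ⊥-elim (a≢a refl)
  ... | elsewhere a≢a _ _  = ⊥-elim (a≢a refl)

  swap-at-b : swapSubsets a b b ≡ a
  swap-at-b with swapView a b b
  ... | at-a b≡a τb≡b      = trans τb≡b b≡a
  ... | at-b _ _ τb≡a      = τb≡a
  ... | elsewhere _ b≢b _  = ⊥-elim (b≢b refl)

  swap-fixes : (S : Subset n) → S ≢ a → S ≢ b → swapSubsets a b S ≡ S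
  swap-fixes S S≢a S≢b with swapView a b S
  ... | at-a S≡a _         = ⊥-elim (S≢a S≡a)
  ... | at-b _ S≡b _       = ⊥-elim (S≢b S≡b)
  ... | elsewhere _ _ τS≡S = τS≡S

  swap-reflects : (P : Subset n → Set) → P a → P b → (S : Subset n) → P (swapSubsets a b S) → P S
  swap-reflects P Pa Pb S PτS with swapView a b S
  ... | at-a refl _        = Pa
  ... | at-b _ refl _      = Pb
  ... | elsewhere _ _ τS≡S = subst P τS≡S PτS

  swap-involutive : (S : Subset n) → swapSubsets a b (swapSubsets a b S) ≡ S
  swap-involutive S with swapView a b S
  ... | at-a refl τS≡b     = trans (cong (swapSubsets a b) τS≡b) swap-at-b
  ... | at-b _ refl τS≡a   = trans (cong (swapSubsets a b) τS≡a) swap-at-a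
  ... | elsewhere _ _ τS≡S = trans (cong (swapSubsets a b) τS≡S) τS≡S

  swap-invariant : (f : Subset n → B) → f a ≡ f b → (S : Subset n) → f (swapSubsets a b S) ≡ f S
  swap-invariant f fa≡fb S with swapView a b S
  ... | at-a refl τS≡b     = trans (cong f τS≡b) (sym fa≡fb)
  ... | at-b _ refl τS≡a   = trans (cong f τS≡a) fa≡fb
  ... | elsewhere _ _ τS≡S = cong f τS≡S

-- Symmetries of the outcome space

PairOutside : Subset n → (Subset n → Bool) → Subset n → Set
PairOutside W 𝔽 C = ∣ C ∣ ≡ 2 × C ⊆ W × 𝔽 C ≡ false

record Symmetry (W : Subset n) : Set where
  field
    to from  : Subset n → Subset n
    from∘to  : ∀ S → from (to S) ≡ S
    to∘from  : ∀ S → to (from S) ≡ S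
    ∣to∣     : ∀ S → ∣ to S ∣ ≡ ∣ S ∣
    to-⊆W    : ∀ S → subB (to S) W ≡ subB S W

  from-⊆W : ∀ S → subB (from S) W ≡ subB S W
  from-⊆W S = trans (sym (to-⊆W (from S))) (cong (λ T → subB T W) (to∘from S))

  ∣from∣ : ∀ S → ∣ from S ∣ ≡ ∣ S ∣
  ∣from∣ S = trans (sym (∣to∣ (from S))) (cong ∣_∣ (to∘from S))

  PairOutside-from : {𝔽 𝔽′ : Subset n → Bool} → (∀ C → 𝔽 (from C) ≡ 𝔽′ C) →
    (C : Subset n) → PairOutside W 𝔽 (from C) → PairOutside W 𝔽′ C
  PairOutside-from 𝔽∘from≗𝔽′ C (∣fromC∣ , fromC⊆W , 𝔽fromC) =
    trans (sym (∣from∣ C)) ∣fromC∣ ,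
    subB-true⁻ C W (trans (sym (from-⊆W C)) (subB-true⁺ (from C) W fromC⊆W)) ,
    trans (sym (𝔽∘from≗𝔽′ C)) 𝔽fromC

swapSymmetry : {W : Subset n} (a b : Subset n) → ∣ a ∣ ≡ ∣ b ∣ → subB a W ≡ subB b W → Symmetry W
swapSymmetry {W = W} a b ∣a∣≡∣b∣ a⊆W≡b⊆W = record
  { to      = swapSubsets a b
  ; from    = swapSubsets a b
  ; from∘to = swap-involutive a b
  ; to∘from = swap-involutive a b
  ; ∣to∣    = swap-invariant a b ∣_∣ ∣a∣≡∣b∣
  ; to-⊆W   = swap-invariant a b (λ S → subB S W) a⊆W≡b⊆W
  }

relabelSymmetry : (σ : Permutation′ n) {W : Subset n} → relabel σ W ≡ W → Symmetry W
relabelSymmetry σ {W} σW≡W = record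
  { to      = relabel σ
  ; from    = relabel (flip σ)
  ; from∘to = relabel-flip σ
  ; to∘from = relabel-flip (flip σ)
  ; ∣to∣    = ∣relabel∣ σ
  ; to-⊆W   = λ S → trans (cong (subB (relabel σ S)) (sym σW≡W)) (subB-relabel σ S W)
  }

relabel-invariant : (σ : Permutation′ n) {W : Subset n} → (∀ u → u ∈ₛ W → σ ⟨$⟩ʳ u ∈ₛ W) → relabel σ W ≡ W
relabel-invariant σ {W} σW⊆W = ⊆∧∣≡∣⇒≡
  (λ j∈ → subst (_∈ₛ W) (inverseʳ σ) (σW⊆W _ (∈-relabel⁻ σ j∈)))
  (∣relabel∣ σ W)

countL-∘-relabel : (σ : Permutation′ n) (f : Subset n → Bool) →
  countL (f ∘ relabel σ) (allSubsets n) ≡ countL f (allSubsets n)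
countL-∘-relabel {n} σ = countL-∘-bijection (relabel σ) (relabel (flip σ)) (relabel-flip σ) (relabel-flip (flip σ))
  (allSubsets-unique n) ∈-allSubsets

anyV-true⁺ : (f : A → Bool) (ω : Vec A m) (i : Fin m) → f (lookup ω i) ≡ true → anyV f ω ≡ true
anyV-true⁺ f (x ∷ ω) zero    e = ∨-true⁺ˡ e
anyV-true⁺ f (x ∷ ω) (suc i) e = ∨-true⁺ʳ {f x} (anyV-true⁺ f ω i e)

anyV-true⁻ : (f : A → Bool) (ω : Vec A m) → anyV f ω ≡ true → ∃[ i ] f (lookup ω i) ≡ true
anyV-true⁻ f (x ∷ ω) e with ∨-true⁻ {f x} e
... | inj₁ fx   = zero , fx
... | inj₂ rest with i , fωi ← anyV-true⁻ f ω rest = suc i , fωi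

anyV-map : (f : B → Bool) (g : A → B) (ω : Vec A m) → anyV f (Vec.map g ω) ≡ anyV (f ∘ g) ω
anyV-map f g []      = refl
anyV-map f g (x ∷ ω) = cong (f (g x) ∨_) (anyV-map f g ω)

anyV-cong : {f g : A → Bool} (ω : Vec A m) → (∀ x → f x ≡ g x) → anyV f ω ≡ anyV g ω
anyV-cong []      _ = refl
anyV-cong (x ∷ ω) h = cong₂ _∨_ (h x) (anyV-cong ω h)

builtB-true⁺ : (ω : Vec (Subset n) m) (i : Fin m) → builtB (lookup ω i) ω ≡ true
builtB-true⁺ ω i = anyV-true⁺ (eqSubB (lookup ω i)) ω i (eqSubB-refl (lookup ω i))

builtB-true⁻ : (C : Subset n) (ω : Vec (Subset n) m) → builtB C ω ≡ true → ∃[ i ] lookup ω i ≡ C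
builtB-true⁻ C ω e with i , C≡ωi ← anyV-true⁻ (eqSubB C) ω e = i , sym (eqSubB-true⁻ C (lookup ω i) C≡ωi)

probOutcome-map : (p : ℚ) (W : Subset n) (f : Subset n → Subset n) → (∀ S → ∣ f S ∣ ≡ ∣ S ∣) →
  (ω : Vec (Subset n) m) → probOutcome p W (Vec.map f ω) ≡ probOutcome p W ω
probOutcome-map p W f ∣f∣ []      = refl
probOutcome-map p W f ∣f∣ (S ∷ ω) =
  cong₂ _*_ (cong (λ k → (p ^ℚ k) * ((1ℚ - p) ^ℚ (∣ W ∣ ∸ k))) (∣f∣ S)) (probOutcome-map p W f ∣f∣ ω)

∈-subsetsOf⁺ : {W S : Subset n} → subB S W ≡ true → S ∈ subsetsOf W
∈-subsetsOf⁺ {S = S} S⊆W = ∈-filterL⁺ _ (∈-allSubsets S) S⊆W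

∈-subsetsOf⁻ : {W S : Subset n} → S ∈ subsetsOf W → subB S W ≡ true
∈-subsetsOf⁻ {n} S∈ = proj₂ (∈-filterL⁻ _ (allSubsets n) S∈)

coveredB : Subset n → Vec (Subset n) m → Bool
coveredB C ω = anyV (subB C) ω

realisesAt : (𝔽 𝔾 : Subset n → Bool) → Vec (Subset n) m → Subset n → Bool
realisesAt 𝔽 𝔾 ω C = (not (𝔾 C) ∨ builtB C ω) ∧ (not (𝔽 C) ∨ (not (builtB C ω) ∧ coveredB C ω))

realises : (𝔽 𝔾 : Subset n → Bool) → Vec (Subset n) m → Bool
realises {n} 𝔽 𝔾 ω = allL (realisesAt 𝔽 𝔾 ω) (allSubsets n)

realisesAt-true⁺ : (𝔽 𝔾 : Subset n → Bool) (ω : Vec (Subset n) m) (C : Subset n) →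
  (𝔾 C ≡ true → builtB C ω ≡ true) → (𝔽 C ≡ true → builtB C ω ≡ false × coveredB C ω ≡ true) →
  realisesAt 𝔽 𝔾 ω C ≡ true
realisesAt-true⁺ 𝔽 𝔾 ω C 𝔾⇒built 𝔽⇒unbuilt-covered = ∧-true⁺ (⇒-true⁺ 𝔾⇒built) (⇒-true⁺ (λ 𝔽C →
  let unbuilt , covered = 𝔽⇒unbuilt-covered 𝔽C in ∧-true⁺ (cong not unbuilt) covered))

realisesAt-true⁻ : (𝔽 𝔾 : Subset n → Bool) (ω : Vec (Subset n) m) (C : Subset n) → realisesAt 𝔽 𝔾 ω C ≡ true →
  (𝔾 C ≡ true → builtB C ω ≡ true) × (𝔽 C ≡ true → builtB C ω ≡ false × coveredB C ω ≡ true)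
realisesAt-true⁻ 𝔽 𝔾 ω C e =
  let 𝔾-part , 𝔽-part = ∧-true⁻ e in
  ⇒-true⁻ 𝔾-part , λ 𝔽C → let unbuilt , covered = ∧-true⁻ (⇒-true⁻ 𝔽-part 𝔽C) in not-true⇒false unbuilt , covered

realises-cong : {𝔽 𝔽′ 𝔾 𝔾′ : Subset n → Bool} → (∀ C → 𝔽 C ≡ 𝔽′ C) → (∀ C → 𝔾 C ≡ 𝔾′ C) →
  (ω : Vec (Subset n) m) → realises 𝔽 𝔾 ω ≡ realises 𝔽′ 𝔾′ ω
realises-cong {n} 𝔽≗𝔽′ 𝔾≗𝔾′ ω = allL-cong _ _ (allSubsets n) λ C _ →
  cong₂ (λ f g → (not g ∨ builtB C ω) ∧ (not f ∨ (not (builtB C ω) ∧ coveredB C ω))) (𝔽≗𝔽′ C) (𝔾≗𝔾′ C)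

module _ {W : Subset n} (s : Symmetry W) where
  open Symmetry s

  eqSubB-to : (C S : Subset n) → eqSubB C (to S) ≡ eqSubB (from C) S
  eqSubB-to C S = true⇔true⇒≡
    (λ e → eqSubB-true⁺ (trans (cong from (eqSubB-true⁻ C (to S) e)) (from∘to S)))
    (λ e → eqSubB-true⁺ (trans (sym (to∘from C)) (cong to (eqSubB-true⁻ (from C) S e))))

  builtB-map-to : (C : Subset n) (ω : Vec (Subset n) m) → builtB C (Vec.map to ω) ≡ builtB (from C) ω
  builtB-map-to C ω = trans (anyV-map (eqSubB C) to ω) (anyV-cong ω (eqSubB-to C))

  -- Only inclusions of 𝔽-sets matter: coverage is never asked of any other set.
  realises-map-to : (𝔽 𝔾 : Subset n → Bool) → (∀ D S → 𝔽 D ≡ true → subB (to D) (to S) ≡ subB D S) →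
    (ω : Vec (Subset n) m) → realises (𝔽 ∘ from) (𝔾 ∘ from) (Vec.map to ω) ≡ realises 𝔽 𝔾 ω
  realises-map-to 𝔽 𝔾 to-⊆ ω = begin
    allL (realisesAt (𝔽 ∘ from) (𝔾 ∘ from) (Vec.map to ω)) (allSubsets n)
      ≡⟨ allL-cong _ _ (allSubsets n) (λ C _ → pointwise C) ⟩
    allL (realisesAt 𝔽 𝔾 ω ∘ from) (allSubsets n)
      ≡⟨ allL-map (realisesAt 𝔽 𝔾 ω) from (allSubsets n) ⟨
    allL (realisesAt 𝔽 𝔾 ω) (map from (allSubsets n))
      ≡⟨ allL-↭ (realisesAt 𝔽 𝔾 ω) (map-bijection-↭ from to to∘from from∘to (allSubsets-unique n) (λ _ → ∈-allSubsets _) (λ _ → ∈-allSubsets _)) ⟩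
    allL (realisesAt 𝔽 𝔾 ω) (allSubsets n)
      ∎
    where
    open ≡-Reasoning
    covered : ∀ C → 𝔽 (from C) ≡ true → coveredB C (Vec.map to ω) ≡ coveredB (from C) ω
    covered C 𝔽C = trans (anyV-map (subB C) to ω) (anyV-cong ω λ S →
      trans (cong (λ D → subB D (to S)) (sym (to∘from C))) (to-⊆ (from C) S 𝔽C))
    pointwise : ∀ C → realisesAt (𝔽 ∘ from) (𝔾 ∘ from) (Vec.map to ω) C ≡ realisesAt 𝔽 𝔾 ω (from C)
    pointwise C rewrite builtB-map-to C ω with 𝔽 (from C) in 𝔽C
    ... | false = refl
    ... | true  = cong (λ c → (not (𝔾 (from C)) ∨ builtB (from C) ω) ∧ (not (builtB (from C) ω) ∧ c)) (covered C 𝔽C)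

-- Logical readings of graphs, covers and 𝒦

allFin²-true⁺ : (f : Fin n → Fin n → Bool) → (∀ u v → f u v ≡ true) →
  allL (λ u → allL (f u) (allFin n)) (allFin n) ≡ true
allFin²-true⁺ {n} f h = allL-true⁺ _ (allFin n) λ u _ → allL-true⁺ (f u) (allFin n) λ v _ → h u v

allFin²-true⁻ : (f : Fin n → Fin n → Bool) → allL (λ u → allL (f u) (allFin n)) (allFin n) ≡ true →
  ∀ u v → f u v ≡ true
allFin²-true⁻ f e u v = allL-true⁻ (f u) (allL-true⁻ _ e u (∈-allFin u)) v (∈-allFin v)

anyFin²-true⁺ : (f : Fin n → Fin n → Bool) (u v : Fin n) → f u v ≡ true →
  anyL (λ u → anyL (f u) (allFin n)) (allFin n) ≡ true
anyFin²-true⁺ f u v e = anyL-true⁺ _ (∈-allFin u) (anyL-true⁺ (f u) (∈-allFin v) e)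

anyFin²-true⁻ : (f : Fin n → Fin n → Bool) → anyL (λ u → anyL (f u) (allFin n)) (allFin n) ≡ true →
  ∃[ u ] ∃[ v ] f u v ≡ true
anyFin²-true⁻ {n} f e with u , _ , e′ ← anyL-true⁻ _ (allFin n) e with v , _ , fuv ← anyL-true⁻ (f u) (allFin n) e′
  = u , v , fuv

isEdgeB-true⁺ : (A : Adj n) (u v : Fin n) → A u v ≡ true → isEdgeB A (edgeSet u v) ≡ true
isEdgeB-true⁺ A u v Auv = anyFin²-true⁺ _ u v (∧-true⁺ Auv (eqSubB-refl (edgeSet u v)))

isEdgeB-true⁻ : (A : Adj n) (C : Subset n) → isEdgeB A C ≡ true → ∃[ u ] ∃[ v ] A u v ≡ true × C ≡ edgeSet u v
isEdgeB-true⁻ A C e with u , v , e′ ← anyFin²-true⁻ _ e =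
  let Auv , C≡uv = ∧-true⁻ e′ in u , v , Auv , eqSubB-true⁻ C (edgeSet u v) C≡uv

memB-true⁺ : {D : Subset n} {𝒞 : List (Subset n)} → D ∈ 𝒞 → memB D 𝒞 ≡ true
memB-true⁺ {D = D} D∈𝒞 = anyL-true⁺ (eqSubB D) D∈𝒞 (eqSubB-refl D)

memB-true⁻ : {D : Subset n} (𝒞 : List (Subset n)) → memB D 𝒞 ≡ true → D ∈ 𝒞
memB-true⁻ {D = D} 𝒞 e with D′ , D′∈𝒞 , D≡D′ ← anyL-true⁻ (eqSubB D) 𝒞 e =
  subst (_∈ 𝒞) (sym (eqSubB-true⁻ D D′ D≡D′)) D′∈𝒞

∈-PList⁺ : {W C : Subset n} (A : Adj n) {u v : Fin n} → C ⊆ W → A u v ≡ true → u ∈ₛ C → v ∈ₛ C → C ∈ PList W A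
∈-PList⁺ {n} {W} {C} A {u} {v} C⊆W Auv u∈C v∈C = ∈-filterL⁺ (inPB W A) (∈-allSubsets C)
  (∧-true⁺ (subB-true⁺ C W C⊆W) (anyFin²-true⁺ _ u v (∧-true⁺ Auv (∧-true⁺ ([]=⇒lookup u∈C) ([]=⇒lookup v∈C)))))

Covers : Adj n → List (Subset n) → Set
Covers A 𝒞 = ∀ u v → A u v ≡ true → ∃[ C ] C ∈ 𝒞 × u ∈ₛ C × v ∈ₛ C

coverB-true⁺ : (A : Adj n) (𝒞 : List (Subset n)) → Covers A 𝒞 → coverB A 𝒞 ≡ true
coverB-true⁺ A 𝒞 covers = allFin²-true⁺ _ λ u v → ⇒-true⁺ λ Auv →
  let C , C∈𝒞 , u∈C , v∈C = covers u v Auv in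
  anyL-true⁺ _ C∈𝒞 (∧-true⁺ ([]=⇒lookup u∈C) ([]=⇒lookup v∈C))

coverB-true⁻ : (A : Adj n) (𝒞 : List (Subset n)) → coverB A 𝒞 ≡ true → Covers A 𝒞
coverB-true⁻ A 𝒞 e u v Auv with C , C∈𝒞 , e′ ← anyL-true⁻ _ 𝒞 (⇒-true⁻ (allFin²-true⁻ _ e u v) Auv) =
  let Cu , Cv = ∧-true⁻ e′ in C , C∈𝒞 , lookup⇒[]= u C Cu , lookup⇒[]= v C Cv

InK : Adj n → Adj n → List (Subset n) → Set
InK F G 𝒞 = Covers (F ∪ₐ G) 𝒞 × (∀ u v → G u v ≡ true → edgeSet u v ∈ 𝒞) × (∀ C → C ∈ 𝒞 → isEdgeB F C ≡ false)

inKB-true⁺ : (F G : Adj n) (𝒞 : List (Subset n)) → InK F G 𝒞 → inKB F G 𝒞 ≡ true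
inKB-true⁺ F G 𝒞 (covers , G⊆𝒞 , 𝒞∩F≡∅) = ∧-true⁺ (coverB-true⁺ (F ∪ₐ G) 𝒞 covers) (∧-true⁺
  (allFin²-true⁺ _ λ u v → ⇒-true⁺ λ Guv → memB-true⁺ (G⊆𝒞 u v Guv))
  (allL-true⁺ _ 𝒞 λ C C∈𝒞 → cong not (𝒞∩F≡∅ C C∈𝒞)))

inKB-true⁻ : (F G : Adj n) (𝒞 : List (Subset n)) → inKB F G 𝒞 ≡ true → InK F G 𝒞
inKB-true⁻ F G 𝒞 e =
  let cover , rest = ∧-true⁻ e ; G-part , F-part = ∧-true⁻ rest in
  coverB-true⁻ (F ∪ₐ G) 𝒞 cover ,
  (λ u v Guv → memB-true⁻ 𝒞 (⇒-true⁻ (allFin²-true⁻ _ G-part u v) Guv)) ,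
  (λ C C∈𝒞 → not-true⇒false (allL-true⁻ _ F-part C C∈𝒞))

module _ {W : Subset n} (F G : Graph n W) (ω : Vec (Subset n) m) (ω⊆W : ∀ i → lookup ω i ⊆ W) where
  private
    F∪G : Adj n
    F∪G = adj F ∪ₐ adj G
    𝔽 𝔾 : Subset n → Bool
    𝔽 = isEdgeB (adj F)
    𝔾 = isEdgeB (adj G)
    built : Subset n → Bool
    built C = builtB C ω
    𝒞 : List (Subset n)
    𝒞 = filterL built (PList W F∪G)

    edge⊆W : (H : Graph n W) {u v : Fin n} → adj H u v ≡ true → edgeSet u v ⊆ W
    edge⊆W H {u} {v} Huv = let u∈W , v∈W = inW H u v Huv in edgeSet-⊆ u∈W v∈W

    edge∈𝒞 : {u v : Fin n} → F∪G u v ≡ true → edgeSet u v ⊆ W → built (edgeSet u v) ≡ true → edgeSet u v ∈ 𝒞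
    edge∈𝒞 {u} {v} Auv uv⊆W = ∈-filterL⁺ built (∈-PList⁺ F∪G uv⊆W Auv (∈-edgeSetˡ u v) (∈-edgeSetʳ u v))

    attribute∈𝒞 : {u v : Fin n} (i : Fin m) → F∪G u v ≡ true → u ∈ₛ lookup ω i → v ∈ₛ lookup ω i → lookup ω i ∈ 𝒞
    attribute∈𝒞 i Auv u∈ v∈ = ∈-filterL⁺ built (∈-PList⁺ F∪G (ω⊆W i) Auv u∈ v∈) (builtB-true⁺ ω i)

    ∈𝒞⇒built : {C : Subset n} → C ∈ 𝒞 → built C ≡ true
    ∈𝒞⇒built C∈𝒞 = proj₂ (∈-filterL⁻ built (PList W F∪G) C∈𝒞)

    InK⇒realisesAt : InK (adj F) (adj G) 𝒞 → ∀ C → realisesAt 𝔽 𝔾 ω C ≡ true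
    InK⇒realisesAt (covers , G⊆𝒞 , 𝒞∩F≡∅) C = realisesAt-true⁺ 𝔽 𝔾 ω C 𝔾⇒built 𝔽⇒unbuilt-covered
      where
      𝔾⇒built : 𝔾 C ≡ true → built C ≡ true
      𝔾⇒built 𝔾C with u , v , Guv , refl ← isEdgeB-true⁻ (adj G) C 𝔾C = ∈𝒞⇒built (G⊆𝒞 u v Guv)
      𝔽⇒unbuilt-covered : 𝔽 C ≡ true → built C ≡ false × coveredB C ω ≡ true
      𝔽⇒unbuilt-covered 𝔽C with u , v , Fuv , refl ← isEdgeB-true⁻ (adj F) C 𝔽C = unbuilt , covered
        where
        Auv : F∪G u v ≡ true
        Auv = ∨-true⁺ˡ Fuv
        unbuilt : built (edgeSet u v) ≡ false
        unbuilt = ¬true⇒false λ uv-built →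
          true≢false 𝔽C (𝒞∩F≡∅ (edgeSet u v) (edge∈𝒞 Auv (edge⊆W F Fuv) uv-built))
        covered : coveredB (edgeSet u v) ω ≡ true
        covered with D , D∈𝒞 , u∈D , v∈D ← covers u v Auv with i , refl ← builtB-true⁻ D ω (∈𝒞⇒built D∈𝒞) =
          anyV-true⁺ (subB (edgeSet u v)) ω i (subB-true⁺ _ _ (edgeSet-⊆ u∈D v∈D))

    realisesAt⇒InK : (∀ C → realisesAt 𝔽 𝔾 ω C ≡ true) → InK (adj F) (adj G) 𝒞
    realisesAt⇒InK h = covers , G⊆𝒞 , 𝒞∩F≡∅
      where
      𝔾⇒built : ∀ C → 𝔾 C ≡ true → built C ≡ true
      𝔾⇒built C = proj₁ (realisesAt-true⁻ 𝔽 𝔾 ω C (h C))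
      𝔽⇒unbuilt-covered : ∀ C → 𝔽 C ≡ true → built C ≡ false × coveredB C ω ≡ true
      𝔽⇒unbuilt-covered C = proj₂ (realisesAt-true⁻ 𝔽 𝔾 ω C (h C))
      G⊆𝒞 : ∀ u v → adj G u v ≡ true → edgeSet u v ∈ 𝒞
      G⊆𝒞 u v Guv = edge∈𝒞 (∨-true⁺ʳ {adj F u v} Guv) (edge⊆W G Guv) (𝔾⇒built (edgeSet u v) (isEdgeB-true⁺ (adj G) u v Guv))
      covers : Covers F∪G 𝒞
      covers u v Auv with ∨-true⁻ {adj F u v} Auv
      ... | inj₂ Guv = edgeSet u v , G⊆𝒞 u v Guv , ∈-edgeSetˡ u v , ∈-edgeSetʳ u v
      ... | inj₁ Fuv with i , uv⊆ωi ← anyV-true⁻ (subB (edgeSet u v)) ω (proj₂ (𝔽⇒unbuilt-covered (edgeSet u v) (isEdgeB-true⁺ (adj F) u v Fuv))) =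
        let u∈ωi = subB-true⁻ (edgeSet u v) (lookup ω i) uv⊆ωi (∈-edgeSetˡ u v)
            v∈ωi = subB-true⁻ (edgeSet u v) (lookup ω i) uv⊆ωi (∈-edgeSetʳ u v) in
        lookup ω i , attribute∈𝒞 i Auv u∈ωi v∈ωi , u∈ωi , v∈ωi
      𝒞∩F≡∅ : ∀ C → C ∈ 𝒞 → 𝔽 C ≡ false
      𝒞∩F≡∅ C C∈𝒞 = ¬true⇒false λ 𝔽C → true≢false (∈𝒞⇒built C∈𝒞) (proj₁ (𝔽⇒unbuilt-covered C 𝔽C))

  inKB-built≡realises : inKB (adj F) (adj G) (filterL (λ C → builtB C ω) (PList W (adj F ∪ₐ adj G)))
                      ≡ realises (isEdgeB (adj F)) (isEdgeB (adj G)) ω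
  inKB-built≡realises = true⇔true⇒≡
    (λ e → allL-true⁺ _ (allSubsets n) λ C _ → InK⇒realisesAt (inKB-true⁻ (adj F) (adj G) 𝒞 e) C)
    (λ e → inKB-true⁺ (adj F) (adj G) 𝒞 (realisesAt⇒InK λ C → allL-true⁻ _ e C (∈-allSubsets C)))

-- Summing over the subfamilies of a family

⊆-sublists : {L 𝒞 : List A} → 𝒞 ∈ sublists L → ∀ {D} → D ∈ 𝒞 → D ∈ L
⊆-sublists {L = []} (here refl) ()
⊆-sublists {L = x ∷ xs} 𝒞∈ D∈𝒞 with ∈-++⁻ (sublists xs) 𝒞∈
... | inj₁ 𝒞∈xs = there (⊆-sublists 𝒞∈xs D∈𝒞)
... | inj₂ 𝒞∈x∷ with 𝒞′ , 𝒞′∈xs , refl ← ∈-map⁻ (x ∷_) 𝒞∈x∷ with D∈𝒞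
...   | here refl  = here refl
...   | there D∈𝒞′ = there (⊆-sublists 𝒞′∈xs D∈𝒞′)

selects : List (Subset n) → (Subset n → Bool) → List (Subset n) → Bool
selects L β 𝒞 = allL (λ D → if memB D 𝒞 then β D else not (β D)) L

selects-cons-fresh : {x : Subset n} {xs : List (Subset n)} (β : Subset n → Bool) (𝒞 : List (Subset n)) →
  x ∉ xs → selects xs β (x ∷ 𝒞) ≡ selects xs β 𝒞
selects-cons-fresh {x = x} {xs} β 𝒞 x∉xs = allL-cong _ _ xs λ D D∈xs →
  cong (λ b → if b ∨ memB D 𝒞 then β D else not (β D)) (eqSubB-false⁺ D x λ { refl → x∉xs D∈xs })

∑-sublists-selects : (L : List (Subset n)) → Unique L → (β : Subset n → Bool) (h : List (Subset n) → ℚ) →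
  ∑ (sublists L) (λ 𝒞 → if selects L β 𝒞 then h 𝒞 else 0ℚ) ≡ h (filterL β L)
∑-sublists-selects [] _ β h = +-identityʳ (h [])
∑-sublists-selects {n} (x ∷ xs) (x≢xs AllPairs.∷ u) β h = begin
  ∑ (sublists xs ++ map (x ∷_) (sublists xs)) f
    ≡⟨ ∑-++ (sublists xs) _ f ⟩
  ∑ (sublists xs) f + ∑ (map (x ∷_) (sublists xs)) f
    ≡⟨ cong₂ _+_ (∑-cong (sublists xs) without-x) (trans (∑-map (x ∷_) (sublists xs) f) (∑-cong (sublists xs) λ _ → with-x _)) ⟩
  ∑ (sublists xs) (λ 𝒞 → if not (β x) ∧ selects xs β 𝒞 then h 𝒞 else 0ℚ) +
  ∑ (sublists xs) (λ 𝒞 → if β x ∧ selects xs β 𝒞 then h (x ∷ 𝒞) else 0ℚ)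
    ≡⟨ by-cases (β x) ⟩
  h (if β x then x ∷ filterL β xs else filterL β xs)
    ∎
  where
  open ≡-Reasoning
  x∉xs : x ∉ xs
  x∉xs = Unique.Unique[x∷xs]⇒x∉xs (x≢xs AllPairs.∷ u)
  f : List (Subset n) → ℚ
  f 𝒞 = if selects (x ∷ xs) β 𝒞 then h 𝒞 else 0ℚ
  without-x : ∀ {𝒞} → 𝒞 ∈ sublists xs → f 𝒞 ≡ (if not (β x) ∧ selects xs β 𝒞 then h 𝒞 else 0ℚ)
  without-x {𝒞} 𝒞∈ = cong (λ b → if (if b then β x else not (β x)) ∧ selects xs β 𝒞 then h 𝒞 else 0ℚ)
    (¬true⇒false λ x∈𝒞 → x∉xs (⊆-sublists 𝒞∈ (memB-true⁻ 𝒞 x∈𝒞)))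
  with-x : ∀ 𝒞 → f (x ∷ 𝒞) ≡ (if β x ∧ selects xs β 𝒞 then h (x ∷ 𝒞) else 0ℚ)
  with-x 𝒞 rewrite eqSubB-refl x | selects-cons-fresh β 𝒞 x∉xs = refl
  by-cases : ∀ b →
    ∑ (sublists xs) (λ 𝒞 → if not b ∧ selects xs β 𝒞 then h 𝒞 else 0ℚ) +
    ∑ (sublists xs) (λ 𝒞 → if b ∧ selects xs β 𝒞 then h (x ∷ 𝒞) else 0ℚ)
      ≡ h (if b then x ∷ filterL β xs else filterL β xs)
  by-cases true  = trans (cong (_+ ∑ (sublists xs) (λ 𝒞 → if selects xs β 𝒞 then h (x ∷ 𝒞) else 0ℚ)) (∑-zero (sublists xs)))
                         (trans (+-identityˡ _) (∑-sublists-selects xs u β (h ∘ (x ∷_))))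
  by-cases false = trans (cong (_+ _) (∑-sublists-selects xs u β h))
                         (trans (cong (h (filterL β xs) +_) (∑-zero (sublists xs))) (+-identityʳ _))

isEdgeB-relabel : (σ : Permutation′ n) (A B : Adj n) → (∀ u v → A u v ≡ B (σ ⟨$⟩ʳ u) (σ ⟨$⟩ʳ v)) →
  (C : Subset n) → isEdgeB A (relabel (flip σ) C) ≡ isEdgeB B C
isEdgeB-relabel σ A B A≅B C = true⇔true⇒≡ to from
  where
  to : isEdgeB A (relabel (flip σ) C) ≡ true → isEdgeB B C ≡ true
  to e with u , v , Auv , σ⁻¹C≡uv ← isEdgeB-true⁻ A (relabel (flip σ) C) e =
    subst (λ D → isEdgeB B D ≡ true) C≡σuσv (isEdgeB-true⁺ B _ _ (trans (sym (A≅B u v)) Auv))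
    where
    C≡σuσv : edgeSet (σ ⟨$⟩ʳ u) (σ ⟨$⟩ʳ v) ≡ C
    C≡σuσv = trans (sym (relabel-edgeSet σ u v)) (trans (cong (relabel σ) (sym σ⁻¹C≡uv)) (relabel-flip (flip σ) C))
  from : isEdgeB B C ≡ true → isEdgeB A (relabel (flip σ) C) ≡ true
  from e with u , v , Buv , refl ← isEdgeB-true⁻ B C e =
    subst (λ D → isEdgeB A D ≡ true) (sym (relabel-edgeSet (flip σ) u v))
      (isEdgeB-true⁺ A _ _ (trans (A≅B _ _) (trans (cong₂ B (inverseʳ σ) (inverseʳ σ)) Buv)))

edge-pair : {W : Subset n} (H : Graph n W) (C : Subset n) → isEdgeB (adj H) C ≡ true → ∣ C ∣ ≡ 2 × C ⊆ W
edge-pair H C e with u , v , Huv , refl ← isEdgeB-true⁻ (adj H) C e =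
  ∣edgeSet∣≡2 {u = u} {v} (λ { refl → true≢false Huv (irrefl H u) }) ,
  edgeSet-⊆ (proj₁ (inW H u v Huv)) (proj₂ (inW H u v Huv))

edge-outside : {W : Subset n} (F G : Graph n W) → (∀ u v → adj F u v ≡ true → adj G u v ≡ false) →
  (C : Subset n) → isEdgeB (adj G) C ≡ true → PairOutside W (isEdgeB (adj F)) C
edge-outside F G F∩G≡∅ C e with u , v , Guv , refl ← isEdgeB-true⁻ (adj G) C e =
  let ∣C∣ , C⊆W = edge-pair G (edgeSet u v) e in ∣C∣ , C⊆W , ¬true⇒false not-F-edge
  where
  not-F-edge : isEdgeB (adj F) (edgeSet u v) ≢ true
  not-F-edge e′ with u′ , v′ , Fu′v′ , uv≡u′v′ ← isEdgeB-true⁻ (adj F) (edgeSet u v) e′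
    with edgeSet-injective (λ { refl → true≢false Guv (irrefl G u) }) uv≡u′v′
  ... | inj₁ (refl , refl) = true≢false Guv (F∩G≡∅ u v Fu′v′)
  ... | inj₂ (refl , refl) = true≢false Guv (F∩G≡∅ _ _ (trans (Graph.sym F _ _) Fu′v′))

relabelled-edge-outside : {W : Subset n} (σ : Permutation′ n) → (∀ u → u ∈ₛ W → σ ⟨$⟩ʳ u ∈ₛ W) →
  (F F′ G : Graph n W) → (∀ u v → adj F u v ≡ adj F′ (σ ⟨$⟩ʳ u) (σ ⟨$⟩ʳ v)) →
  (∀ u v → adj F u v ≡ true → adj G u v ≡ false) →
  (C : Subset n) → isEdgeB (adj G) (relabel (flip σ) C) ≡ true → PairOutside W (isEdgeB (adj F′)) C
relabelled-edge-outside σ σW⊆W F F′ G F≅F′ F∩G≡∅ C e =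
  Symmetry.PairOutside-from (relabelSymmetry σ (relabel-invariant σ σW⊆W)) {isEdgeB (adj F)}
    (isEdgeB-relabel σ (adj F) (adj F′) F≅F′) C (edge-outside F G F∩G≡∅ (relabel (flip σ) C) e)

-- Probabilities

module Probability {n : ℕ} (m : ℕ) (p : ℚ) (W : Subset n) where

  Ω : List (Vec (Subset n) m)
  Ω = vecsOf (subsetsOf W) m

  Pr : (Vec (Subset n) m → Bool) → ℚ
  Pr E = ∑ Ω (λ ω → if E ω then probOutcome p W ω else 0ℚ)

  Pr-cong : {E E′ : Vec (Subset n) m → Bool} → (∀ ω → E ω ≡ E′ ω) → Pr E ≡ Pr E′
  Pr-cong E≗E′ = ∑-cong Ω (λ {ω} _ → cong (λ b → if b then probOutcome p W ω else 0ℚ) (E≗E′ ω))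

  Pr-invariant : (s : Symmetry W) (E : Vec (Subset n) m → Bool) → Pr (E ∘ Vec.map (Symmetry.to s)) ≡ Pr E
  Pr-invariant s E = begin
    Pr (E ∘ Vec.map to)
      ≡⟨ ∑-cong Ω (λ {ω} _ → cong (λ q → if E (Vec.map to ω) then q else 0ℚ) (sym (probOutcome-map p W to ∣to∣ ω))) ⟩
    ∑ Ω (λ ω → if E (Vec.map to ω) then probOutcome p W (Vec.map to ω) else 0ℚ)
      ≡⟨ ∑-vecsOf-map (subsetsOf W) to subsetsOf-↭ m _ ⟨
    Pr E
      ∎
    where
    open ≡-Reasoning
    open Symmetry s
    subsetsOf-↭ : map to (subsetsOf W) ↭ subsetsOf W
    subsetsOf-↭ = map-bijection-↭ to from from∘to to∘from (filterL-unique _ (allSubsets-unique n))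
      (λ S∈ → ∈-subsetsOf⁺ (trans (to-⊆W _) (∈-subsetsOf⁻ S∈)))
      (λ S∈ → ∈-subsetsOf⁺ (trans (from-⊆W _) (∈-subsetsOf⁻ S∈)))

  Pr-realises-transport : (s : Symmetry W) (𝔽 𝔾 : Subset n → Bool) → let open Symmetry s in
    (∀ D S → 𝔽 D ≡ true → subB (to D) (to S) ≡ subB D S) →
    Pr (realises (𝔽 ∘ from) (𝔾 ∘ from)) ≡ Pr (realises 𝔽 𝔾)
  Pr-realises-transport s 𝔽 𝔾 to-⊆ =
    trans (sym (Pr-invariant s _)) (Pr-cong (realises-map-to s 𝔽 𝔾 to-⊆))

  Pr-realises-relabel : (σ : Permutation′ n) → (∀ u → u ∈ₛ W → σ ⟨$⟩ʳ u ∈ₛ W) → (𝔽 𝔾 : Subset n → Bool) →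
    Pr (realises (𝔽 ∘ relabel (flip σ)) (𝔾 ∘ relabel (flip σ))) ≡ Pr (realises 𝔽 𝔾)
  Pr-realises-relabel σ σW⊆W 𝔽 𝔾 = Pr-realises-transport (relabelSymmetry σ (relabel-invariant σ σW⊆W)) 𝔽 𝔾
    (λ D S _ → subB-relabel σ D S)

  Ω⊆W : {ω : Vec (Subset n) m} → ω ∈ Ω → ∀ i → lookup ω i ⊆ W
  Ω⊆W {ω} ω∈Ω i = subB-true⁻ (lookup ω i) W (∈-subsetsOf⁻ (lookup⁺ (∈-vecsOf⁻ (subsetsOf W) m ω∈Ω) i))

  πK≡Pr-realises : (F G : Graph n W) → πK m p W F G ≡ Pr (realises (isEdgeB (adj F)) (isEdgeB (adj G)))
  πK≡Pr-realises F G = begin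
    ∑ 𝒫s (λ 𝒞 → if K 𝒞 then ∑ Ω (λ ω → if givenByB W F∪G 𝒞 ω then prob ω else 0ℚ) else 0ℚ)
      ≡⟨ ∑-cong 𝒫s (λ {𝒞} _ → ∑-if (K 𝒞) Ω _) ⟩
    ∑ 𝒫s (λ 𝒞 → ∑ Ω (λ ω → if K 𝒞 then (if givenByB W F∪G 𝒞 ω then prob ω else 0ℚ) else 0ℚ))
      ≡⟨ ∑-comm 𝒫s Ω _ ⟩
    ∑ Ω (λ ω → ∑ 𝒫s (λ 𝒞 → if K 𝒞 then (if givenByB W F∪G 𝒞 ω then prob ω else 0ℚ) else 0ℚ))
      ≡⟨ ∑-cong Ω (λ {ω} _ → ∑-cong 𝒫s (λ {𝒞} _ → if-swap (K 𝒞) (givenByB W F∪G 𝒞 ω) (prob ω))) ⟩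
    ∑ Ω (λ ω → ∑ 𝒫s (λ 𝒞 → if selects 𝒫 (built ω) 𝒞 then (if K 𝒞 then prob ω else 0ℚ) else 0ℚ))
      ≡⟨ ∑-cong Ω (λ {ω} _ → ∑-sublists-selects 𝒫 𝒫-unique (built ω) (λ 𝒞 → if K 𝒞 then prob ω else 0ℚ)) ⟩
    ∑ Ω (λ ω → if K (filterL (built ω) 𝒫) then prob ω else 0ℚ)
      ≡⟨ ∑-cong Ω (λ {ω} ω∈Ω → cong (λ b → if b then prob ω else 0ℚ) (inKB-built≡realises F G ω (Ω⊆W ω∈Ω))) ⟩
    Pr (realises (isEdgeB (adj F)) (isEdgeB (adj G)))
      ∎
    where
    open ≡-Reasoning
    F∪G : Adj n
    F∪G = adj F ∪ₐ adj G
    𝒫 : List (Subset n)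
    𝒫 = PList W F∪G
    𝒫s : List (List (Subset n))
    𝒫s = sublists 𝒫
    𝒫-unique : Unique 𝒫
    𝒫-unique = filterL-unique (inPB W F∪G) (allSubsets-unique n)
    K : List (Subset n) → Bool
    K = inKB (adj F) (adj G)
    prob : Vec (Subset n) m → ℚ
    prob = probOutcome p W
    built : Vec (Subset n) m → Subset n → Bool
    built ω D = builtB D ω

  module _ (𝔽 : Subset n → Bool) (𝔽-pairs : ∀ C → 𝔽 C ≡ true → ∣ C ∣ ≡ 2) where

    Pr-realises-swap : {a b : Subset n} → PairOutside W 𝔽 a → PairOutside W 𝔽 b → (𝔾 : Subset n → Bool) →
      Pr (realises 𝔽 (𝔾 ∘ swapSubsets a b)) ≡ Pr (realises 𝔽 𝔾)
    Pr-realises-swap {a} {b} (∣a∣ , a⊆W , 𝔽a) (∣b∣ , b⊆W , 𝔽b) 𝔾 = begin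
      Pr (realises 𝔽 (𝔾 ∘ τ))        ≡⟨ Pr-cong (realises-cong (λ C → sym (𝔽τ≗𝔽 C)) (λ _ → refl)) ⟩
      Pr (realises (𝔽 ∘ τ) (𝔾 ∘ τ))  ≡⟨ Pr-realises-transport s 𝔽 𝔾 τ-⊆ ⟩
      Pr (realises 𝔽 𝔾)              ∎
      where
      open ≡-Reasoning
      τ : Subset n → Subset n
      τ = swapSubsets a b
      s : Symmetry W
      s = swapSymmetry a b (trans ∣a∣ (sym ∣b∣))
            (trans (subB-true⁺ a W a⊆W) (sym (subB-true⁺ b W b⊆W)))
      𝔽τ≗𝔽 : ∀ C → 𝔽 (τ C) ≡ 𝔽 C
      𝔽τ≗𝔽 = swap-invariant a b 𝔽 (trans 𝔽a (sym 𝔽b))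
      -- An 𝔽-set has two elements, so it lies in a pair only if it is that pair.
      ⊈-outside : ∀ {D c} → 𝔽 D ≡ true → ∣ c ∣ ≡ 2 → 𝔽 c ≡ false → subB D c ≡ false
      ⊈-outside {D} {c} 𝔽D ∣c∣ 𝔽c = ¬true⇒false λ D⊆c →
        true≢false (subst (λ C → 𝔽 C ≡ true) (⊆∧∣≡∣⇒≡ (subB-true⁻ D c D⊆c) (trans (𝔽-pairs D 𝔽D) (sym ∣c∣))) 𝔽D) 𝔽c
      τ-⊆ : ∀ D S → 𝔽 D ≡ true → subB (τ D) (τ S) ≡ subB D S
      τ-⊆ D S 𝔽D = begin
        subB (τ D) (τ S)  ≡⟨ cong (λ T → subB T (τ S)) (swap-fixes a b D (λ { refl → true≢false 𝔽D 𝔽a }) (λ { refl → true≢false 𝔽D 𝔽b })) ⟩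
        subB D (τ S)      ≡⟨ swap-invariant a b (subB D) (trans (⊈-outside 𝔽D ∣a∣ 𝔽a) (sym (⊈-outside 𝔽D ∣b∣ 𝔽b))) S ⟩
        subB D S          ∎

    Pr-realises-exchange : (𝔾₁ 𝔾₂ : Subset n → Bool) → countL 𝔾₁ (allSubsets n) ≡ countL 𝔾₂ (allSubsets n) →
      (∀ C → 𝔾₁ C ≡ true → PairOutside W 𝔽 C) → (∀ C → 𝔾₂ C ≡ true → PairOutside W 𝔽 C) →
      Pr (realises 𝔽 𝔾₁) ≡ Pr (realises 𝔽 𝔾₂)
    Pr-realises-exchange 𝔾₁ 𝔾₂ counts₁ 𝔾₁-pairs 𝔾₂-pairs = exchange _ 𝔾₁ ≤-refl counts₁ 𝔾₁-pairs
      where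
      _∖_ : (Subset n → Bool) → (Subset n → Bool) → Subset n → Bool
      (𝔾 ∖ 𝔾′) C = 𝔾 C ∧ not (𝔾′ C)
      exchange : (k : ℕ) (𝔾 : Subset n → Bool) → countL (𝔾 ∖ 𝔾₂) (allSubsets n) ℕ.≤ k →
        countL 𝔾 (allSubsets n) ≡ countL 𝔾₂ (allSubsets n) → (∀ C → 𝔾 C ≡ true → PairOutside W 𝔽 C) →
        Pr (realises 𝔽 𝔾) ≡ Pr (realises 𝔽 𝔾₂)
      exchange k 𝔾 bound counts 𝔾-pairs with countL-≡⇒≗-or-exchange 𝔾 𝔾₂ (allSubsets n) counts
      ... | inj₁ 𝔾≗𝔾₂ = Pr-cong (realises-cong (λ _ → refl) (λ C → 𝔾≗𝔾₂ (∈-allSubsets C)))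
      ... | inj₂ ((a , a∈ , 𝔾a , 𝔾₂a) , (b , _ , 𝔾₂b , 𝔾b)) =
        trans (sym (Pr-realises-swap (𝔾-pairs a 𝔾a) (𝔾₂-pairs b 𝔾₂b) 𝔾)) (recurse k bound)
        where
        τ : Subset n → Subset n
        τ = swapSubsets a b
        fewer : countL ((𝔾 ∘ τ) ∖ 𝔾₂) (allSubsets n) ℕ.< countL (𝔾 ∖ 𝔾₂) (allSubsets n)
        fewer = countL-mono-< ((𝔾 ∘ τ) ∖ 𝔾₂) (𝔾 ∖ 𝔾₂) (λ {C} _ → still-missing C) a∈
          (∧-true⁺ 𝔾a (cong not 𝔾₂a)) (cong (λ c → c ∧ not (𝔾₂ a)) (trans (cong 𝔾 (swap-at-a a b)) 𝔾b))
          where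
          still-missing : ∀ C → ((𝔾 ∘ τ) ∖ 𝔾₂) C ≡ true → (𝔾 ∖ 𝔾₂) C ≡ true
          still-missing C e with swapView a b C
          ... | at-a refl τa≡b     = ⊥-elim (true≢false (proj₁ (∧-true⁻ e)) (trans (cong 𝔾 τa≡b) 𝔾b))
          ... | at-b _ refl _      = ⊥-elim (true≢false (proj₂ (∧-true⁻ {𝔾 (τ b)} e)) (cong not 𝔾₂b))
          ... | elsewhere _ _ τC≡C = subst (λ D → (𝔾 D ∧ not (𝔾₂ C)) ≡ true) τC≡C e
        counts′ : countL (𝔾 ∘ τ) (allSubsets n) ≡ countL 𝔾₂ (allSubsets n)
        counts′ = trans (countL-∘-bijection τ τ (swap-involutive a b) (swap-involutive a b)
                           (allSubsets-unique n) ∈-allSubsets 𝔾) counts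
        𝔾τ-pairs : ∀ C → 𝔾 (τ C) ≡ true → PairOutside W 𝔽 C
        𝔾τ-pairs C 𝔾τC = swap-reflects a b (PairOutside W 𝔽) (𝔾-pairs a 𝔾a) (𝔾₂-pairs b 𝔾₂b) C (𝔾-pairs (τ C) 𝔾τC)
        recurse : ∀ k → countL (𝔾 ∖ 𝔾₂) (allSubsets n) ℕ.≤ k → Pr (realises 𝔽 (𝔾 ∘ τ)) ≡ Pr (realises 𝔽 𝔾₂)
        recurse zero    bound = ⊥-elim (n≮0 (<-≤-trans fewer bound))
        recurse (suc k) bound = exchange k (𝔾 ∘ τ) (≤-pred (<-≤-trans fewer bound)) counts′ 𝔾τ-pairs

corollary5p3 : (n m : ℕ) (p : ℚ) → 0ℚ ≤ p → p ≤ 1ℚ →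
    (W : Subset n) (F F' G G' : Graph n W) →
    Isomorphic F F' →
    edgeCount (adj G) ≡ edgeCount (adj G') →
    (∀ u v → adj F u v ≡ true → adj G u v ≡ false) →
    (∀ u v → adj F' u v ≡ true → adj G' u v ≡ false) →
    πK m p W F G ≡ πK m p W F' G'
corollary5p3 n m p _ _ W F F′ G G′ (σ , σW⊆W , F≅F′) ∣G∣≡∣G′∣ F∩G≡∅ F′∩G′≡∅ = begin
  πK m p W F G                       ≡⟨ πK≡Pr-realises F G ⟩
  Pr (realises 𝔽 𝔾)                  ≡⟨ Pr-realises-relabel σ σW⊆W 𝔽 𝔾 ⟨
  Pr (realises (𝔽 ∘ σ⁻¹) (𝔾 ∘ σ⁻¹))  ≡⟨ Pr-cong (realises-cong (isEdgeB-relabel σ (adj F) (adj F′) F≅F′) (λ _ → refl)) ⟩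
  Pr (realises 𝔽′ (𝔾 ∘ σ⁻¹))         ≡⟨ Pr-realises-exchange 𝔽′ (λ C → proj₁ ∘ edge-pair F′ C) (𝔾 ∘ σ⁻¹) 𝔾′
                                          (trans (countL-∘-relabel (flip σ) 𝔾) ∣G∣≡∣G′∣)
                                          (relabelled-edge-outside σ σW⊆W F F′ G F≅F′ F∩G≡∅)
                                          (edge-outside F′ G′ F′∩G′≡∅) ⟩
  Pr (realises 𝔽′ 𝔾′)                ≡⟨ πK≡Pr-realises F′ G′ ⟨
  πK m p W F′ G′                     ∎
  where
  open ≡-Reasoning
  open Probability m p W
  σ⁻¹ : Subset n → Subset n
  σ⁻¹ = relabel (flip σ)
  𝔽 𝔾 𝔽′ 𝔾′ : Subset n → Bool
  𝔽  = isEdgeB (adj F)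
  𝔾  = isEdgeB (adj G)
  𝔽′ = isEdgeB (adj F′)
  𝔾′ = isEdgeB (adj G′)
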